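{- Let $k\ge 11$, $r=\frac{9-\sqrt{11}}{7}$, and let $G,\mathcal{F},G',\mathcal{W}$ be as in the context. Let $K$ be a balanced connected component of $\mathcal{F}+\mathcal{W}$, i.e. its center element $K_c$ is a short cycle, exactly one vertex of $K_c$ is a 2-anchor, and all other vertices of $K_c$ are 0-anchors. Then $K$ has a $k$-pp with at least $r|F_K|+5-6r$ edges, where $F_K=E(K)\cap E(\mathcal{F})$.
   Context: $G=(V,E)$ is a simple undirected graph. A $k$-pp of a graph is a spanning subgraph whose components are paths with at most $k$ vertices. A path-cycle cover is a spanning subgraph whose components are paths or cycles; $\mathcal{F}$ is a triangle-free one (no 3-cycle components) of $G$ with maximum number of edges. A short cycle is a cycle component of $\mathcal{F}$ with 4 or 5 vertices. $G'$ is the spanning subgraph of $G$ with edges $\{u,v\}\in E$ such that $u,v$ lie in different components of $\mathcal{F}$ and at least one lies in a short cycle. A short cycle is saturated by $E'\subseteq E(G')$ if some edge of $E'$ is incident to one of its vertices; the weight of $E'$ is the number of short cycles saturated by $E'$. $\mathcal{W}$ is a path-cycle cover of $G'$ maximizing the weight of $E(\mathcal{W})$ and stingy (removing any edge of $\mathcal{W}$ strictly decreases the weight). $\mathcal{F}+\mathcal{W}=(V,E(\mathcal{F})\cup E(\mathcal{W}))$. For a component $K$, $(K)_m$ is obtained by contracting each component of $\mathcal{F}$ in $K$ to a node, nodes adjacent iff $\mathcal{W}$ has an edge between the corresponding components; $(K)_m$ is always a single node, an edge or a star (one center of degree $\ge2$, others of degree 1), and every satellite corresponds to a short cycle. The center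 element $K_c$ is the component of $\mathcal{F}$ corresponding to: the unique node if $(K)_m$ is a single node; the center if $(K)_m$ is a star; if $(K)_m$ is an edge, an endpoint chosen so that the other endpoint corresponds to a short cycle (arbitrary if both qualify). A vertex of $K_c$ is a $j$-anchor ($j\in\{0,1,2\}$) if it is incident to exactly $j$ edges of $\mathcal{W}$. -}

module Defs where

open import Data.Nat as ℕ using (ℕ; zero; suc; _+_; _≤_; _<_)
open import Data.Fin as Fin using (Fin; toℕ; _≟_)
open import Data.Bool using (Bool; true; false; _∧_; _∨_; if_then_else_)
open import Data.List using (List; length; map; allFin)
open import Data.Nat.ListAction using (sum)
open import Data.List.Membership.Propositional using (_∈_)
open import Data.List.Relation.Unary.Unique.Propositional using (Unique)
open import Data.Product using (Σ; ∃; _×_; _,_; proj₁; proj₂)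
open import Data.Sum using (_⊎_)
open import Data.Integer as ℤ using (ℤ; +_)
open import Relation.Nullary using (¬_; does)
open import Relation.Binary.PropositionalEquality using (_≡_; _≢_)
open import Function.Bundles using (_⇔_)
open import Function.Definitions using (Injective)

Graph : ℕ → Set
Graph n = Fin n → Fin n → Bool

IsSimple : ∀ {n} → Graph n → Set
IsSimple {n} H = (∀ (u v : Fin n) → H u v ≡ H v u) × (∀ (u : Fin n) → H u u ≡ false)

SubgraphOf : ∀ {n} → Graph n → Graph n → Set
SubgraphOf {n} H G = ∀ (u v : Fin n) → H u v ≡ true → G u v ≡ true

Card : {A : Set} → (A → Set) → ℕ → Set
Card {A} P c = Σ (List A) λ xs → Unique xs × (∀ x → (x ∈ xs) ⇔ P x) × length xs ≡ c

edges : ∀ {n} → Graph n → ℕ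
edges {n} H = sum (map (λ i → sum (map (λ j →
  if does (toℕ i ℕ.<? toℕ j) ∧ H i j then 1 else 0) (allFin n))) (allFin n))

deg : ∀ {n} → Graph n → Fin n → ℕ
deg {n} H v = sum (map (λ u → if H v u then 1 else 0) (allFin n))

data Reach {n} (H : Graph n) (u : Fin n) : Fin n → Set where
  here : Reach H u u
  step : ∀ {v w} → Reach H u v → H v w ≡ true → Reach H u w

IsPathComp : ∀ {n} → Graph n → Fin n → ℕ → Set
IsPathComp {n} H v m = Σ (Fin m → Fin n) λ f →
  Injective _≡_ _≡_ f ×
  (∀ u → Reach H v u ⇔ (∃ λ i → f i ≡ u)) ×
  (∀ i j → (H (f i) (f j) ≡ true) ⇔ (suc (toℕ i) ≡ toℕ j ⊎ suc (toℕ j) ≡ toℕ i))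

CycAdj : (m : ℕ) → Fin m → Fin m → Set
CycAdj m i j = suc (toℕ i) ≡ toℕ j ⊎ (suc (toℕ i) ≡ m × toℕ j ≡ 0)

IsCycleComp : ∀ {n} → Graph n → Fin n → ℕ → Set
IsCycleComp {n} H v m = 3 ≤ m × (Σ (Fin m → Fin n) λ f →
  Injective _≡_ _≡_ f ×
  (∀ u → Reach H v u ⇔ (∃ λ i → f i ≡ u)) ×
  (∀ i j → (H (f i) (f j) ≡ true) ⇔ (CycAdj m i j ⊎ CycAdj m j i)))

PathCycleCover : ∀ {n} → Graph n → Graph n → Set
PathCycleCover {n} G H = IsSimple H × SubgraphOf H G ×
  (∀ (v : Fin n) → (∃ λ m → IsPathComp H v m) ⊎ (∃ λ m → IsCycleComp H v m))

TriangleFreePCC : ∀ {n} → Graph n → Graph n → Set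
TriangleFreePCC {n} G H = PathCycleCover G H × (∀ (v : Fin n) m → IsCycleComp H v m → m ≢ 3)

MaxTFPCC : ∀ {n} → Graph n → Graph n → Set
MaxTFPCC {n} G F = TriangleFreePCC G F × (∀ F' → TriangleFreePCC G F' → edges F' ≤ edges F)

InShort : ∀ {n} → Graph n → Fin n → Set
InShort F v = ∃ λ m → IsCycleComp F v m × (m ≡ 4 ⊎ m ≡ 5)

IsG' : ∀ {n} → Graph n → Graph n → Graph n → Set
IsG' {n} G F G' = ∀ (u v : Fin n) →
  (G' u v ≡ true) ⇔ (G u v ≡ true × ¬ Reach F u v × (InShort F u ⊎ InShort F v))

-- s is the canonical representative (least vertex) of a short cycle of F
ShortRep : ∀ {n} → Graph n → Fin n → Set
ShortRep F s = InShort F s × (∀ u → Reach F s u → toℕ s ≤ toℕ u)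

Saturated : ∀ {n} → Graph n → Graph n → Fin n → Set
Saturated F W s = ∃ λ u → Reach F s u × (∃ λ w → W u w ≡ true)

Weight : ∀ {n} → Graph n → Graph n → ℕ → Set
Weight F W c = Card (λ s → ShortRep F s × Saturated F W s) c

removeEdge : ∀ {n} → Graph n → Fin n → Fin n → Graph n
removeEdge W u v x y =
  if (does (x ≟ u) ∧ does (y ≟ v)) ∨ (does (x ≟ v) ∧ does (y ≟ u)) then false else W x y

MaxStingy : ∀ {n} → Graph n → Graph n → Graph n → Set
MaxStingy {n} G' F W = PathCycleCover G' W ×
  (∀ W' c c' → PathCycleCover G' W' → Weight F W c → Weight F W' c' → c' ≤ c) ×
  (∀ (u v : Fin n) → W u v ≡ true → ∀ c c' →
     Weight F W c → Weight F (removeEdge W u v) c' → c' < c)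

_⊕_ : ∀ {n} → Graph n → Graph n → Graph n
(F ⊕ W) x y = F x y ∨ W x y

-- adjacency in the contracted graph: some W-edge joins the F-components of a and b
MAdj : ∀ {n} → Graph n → Graph n → Fin n → Fin n → Set
MAdj F W a b = ∃ λ a' → ∃ λ b' → Reach F a a' × Reach F b b' × W a' b' ≡ true

IsCenter : ∀ {n} → Graph n → Graph n → Fin n → Fin n → Set
IsCenter {n} F W x c = Reach (F ⊕ W) x c ×
  ( -- (K)_m is a single node
    (∀ v → Reach (F ⊕ W) x v → Reach F c v)
  ⊎ -- the node of c has degree ≥ 2 in (K)_m (the center of a star)
    (∃ λ b → ∃ λ d → MAdj F W c b × MAdj F W c d × ¬ Reach F b d)
  ⊎ -- (K)_m is an edge whose other endpoint is a short cycle
    (∃ λ d → Reach (F ⊕ W) x d × ¬ Reach F c d × InShort F d ×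
       (∀ v → Reach (F ⊕ W) x v → Reach F c v ⊎ Reach F d v)))

Balanced : ∀ {n} → Graph n → Graph n → Fin n → Fin n → Set
Balanced F W x c = IsCenter F W x c × InShort F c ×
  (∃ λ a → Reach F c a × deg W a ≡ 2 ×
     (∀ b → Reach F c b → b ≢ a → deg W b ≡ 0))

KPP : ∀ {n} → ℕ → Graph n → Graph n → Fin n → Graph n → Set
KPP {n} k F W x P = IsSimple P ×
  (∀ u v → P u v ≡ true → (F ⊕ W) u v ≡ true × Reach (F ⊕ W) x u) ×
  (∀ v → Reach (F ⊕ W) x v → ∃ λ m → IsPathComp P v m × m ≤ k)

FKCount : ∀ {n} → Graph n → Graph n → Fin n → ℕ → Set
FKCount {n} F W x f = Card (λ (p : Fin n × Fin n) →
  toℕ (proj₁ p) < toℕ (proj₂ p) × F (proj₁ p) (proj₂ p) ≡ true × Reach (F ⊕ W) x (proj₁ p)) f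

-- p + q·√11 ≥ 0 (exact, for integers p, q)
NonNegSqrt11 : ℤ → ℤ → Set
NonNegSqrt11 p q =
    (+ 0 ℤ.≤ p × + 0 ℤ.≤ q)
  ⊎ (+ 0 ℤ.≤ p × q ℤ.< + 0 × + 11 ℤ.* (q ℤ.* q) ℤ.≤ p ℤ.* p)
  ⊎ (p ℤ.< + 0 × + 0 ℤ.≤ q × p ℤ.* p ℤ.≤ + 11 ℤ.* (q ℤ.* q))

-- e ≥ r f + 5 - 6 r with r = (9 - √11)/7, i.e. (7e - 9f + 19) + (f - 6)√11 ≥ 0
BoundHolds : ℕ → ℕ → Set
BoundHolds e f = NonNegSqrt11 (+ 7 ℤ.* + e ℤ.- + 9 ℤ.* + f ℤ.+ + 19) (+ f ℤ.- + 6)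

module Submission where

-- The 2-anchor a of the short centre cycle has two W-neighbours b₁ ≠ b₂. Removing {a, b₁} from W keeps
-- the centre cycle saturated (through b₂), so stinginess forces the cycle of b₁ to be short with {a, b₁}
-- as its only W-edge; likewise for b₂. Hence K consists of three short cycles joined by {a, b₁} and {a, b₂}.
-- Cutting the cycle of b₁ next to b₁ and the centre cycle next to a, and joining the two paths by {b₁, a},
-- gives a path on at most 10 vertices; cutting the cycle of b₂ anywhere gives a second path. This k-pp has
-- e = |F_K| − 2 ≥ 10 edges, and the bound follows from 10 ≤ e, f ≤ e + 2 and f ≤ 15.

open import Defs
open import Data.Nat using (ℕ; _≤_)
open import Data.Fin using (Fin)
open import Data.Product using (∃; _×_)

open import Data.Nat as ℕ using (zero; suc; _+_; _*_; _∸_; _<_; z≤n; s≤s; NonZero)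
open import Data.Nat.Properties
open import Data.Nat.DivMod using (_%_; _/_; m%n<n; m%n≤n; m%n%n≡m%n; %-distribˡ-+; m<n⇒m%n≡m;
  n%n≡0; [m+n]%n≡m%n; [m+kn]%n≡m%n; m≡m%n+[m/n]*n)
open import Data.Nat.ListAction using (sum)
open import Data.Nat.Tactic.RingSolver using (solve-∀)
open import Data.Fin as Fin using (toℕ; fromℕ<; fromℕ; inject₁; _↑ˡ_; _↑ʳ_; splitAt)
open import Data.Fin.Properties as Fin using (toℕ-injective; toℕ-fromℕ<; toℕ-fromℕ; toℕ<n; toℕ-inject₁;
  fromℕ<-toℕ; fromℕ<-cong; toℕ-↑ˡ; toℕ-↑ʳ; splitAt⁻¹-↑ˡ; splitAt⁻¹-↑ʳ; any?; all?; ¬∀⟶∃¬; injective⇒≤)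
import Data.Vec.Functional as Vector
open import Data.Vec.Functional.Properties using (lookup-++ˡ; lookup-++ʳ)
import Data.Integer as ℤ
import Data.Integer.Properties as ℤ
open import Data.Bool as Bool using (Bool; true; false; _∧_; _∨_; if_then_else_)
open import Data.Bool.Properties using (∨-zeroʳ)
open import Data.List using (List; []; _∷_; length; map; allFin; filter; _++_; cartesianProduct)
open import Data.List.Properties using (length-map; length-tabulate; length-++)
open import Data.List.Membership.Propositional using (_∈_)
open import Data.List.Membership.Propositional.Properties using (∈-filter⁺; ∈-filter⁻; ∈-allFin;
  ∈-cartesianProduct⁺; ∈-map⁺; ∈-map⁻; ∈-++⁺ˡ; ∈-++⁺ʳ; ∈-++⁻)
open import Data.List.Relation.Unary.Any using (here; there)
open import Data.List.Relation.Unary.All as All using ()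
open import Data.List.Relation.Unary.AllPairs using (_∷_)
open import Data.List.Relation.Unary.Unique.Propositional using (Unique)
import Data.List.Relation.Unary.Unique.Propositional.Properties as Unique
open import Data.Product using (Σ; _,_; proj₁; proj₂)
open import Data.Product.Properties using (≡-dec; ,-injectiveˡ; ,-injectiveʳ)
open import Data.Sum using (_⊎_; inj₁; inj₂; [_,_]′)
import Data.Sum as Sum
open import Data.Empty using (⊥; ⊥-elim)
open import Data.Unit using (⊤; tt)
open import Relation.Nullary using (¬_; Dec; yes; no; does)
open import Relation.Nullary.Decidable using (dec-true; dec-false; does-⇔; map′; toWitness)
open import Relation.Nullary.Decidable.Core using (_×-dec_; _⊎-dec_; _→-dec_; ¬?)
open import Relation.Unary using (Decidable)
open import Relation.Binary.Definitions using (DecidableEquality; tri<; tri≈; tri>)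
open import Relation.Binary.PropositionalEquality
open import Function.Bundles using (_⇔_; mk⇔; Equivalence)
open import Function.Construct.Symmetry using (⇔-sym)
open import Function.Construct.Composition using (_⇔-∘_)
open import Function.Definitions using (Injective)
open import Function.Base using (case_of_)

open Equivalence using (to; from)

does≡true⇔ : {A : Set} (A? : Dec A) → does A? ≡ true ⇔ A
does≡true⇔ (yes a) = mk⇔ (λ _ → a) (λ _ → refl)
does≡true⇔ (no ¬a) = mk⇔ (λ ()) (λ a → ⊥-elim (¬a a))

-- Counting

module _ {A : Set} (_≟_ : DecidableEquality A) where

  remove : A → List A → List A
  remove x [] = []
  remove x (y ∷ ys) with x ≟ y
  ... | yes _ = ys
  ... | no _ = y ∷ remove x ys

  length-remove : ∀ {x} ys → x ∈ ys → suc (length (remove x ys)) ≡ length ys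
  length-remove {x} (y ∷ ys) x∈ with x ≟ y | x∈
  ... | yes _ | _ = refl
  ... | no x≢y | here x≡y = ⊥-elim (x≢y x≡y)
  ... | no _ | there x∈ys = cong suc (length-remove ys x∈ys)

  ∈-remove : ∀ {x z} ys → z ∈ ys → z ≢ x → z ∈ remove x ys
  ∈-remove {x} (y ∷ ys) z∈ z≢x with x ≟ y | z∈
  ... | yes x≡y | here z≡y = ⊥-elim (z≢x (trans z≡y (sym x≡y)))
  ... | yes _ | there z∈ys = z∈ys
  ... | no _ | here z≡y = here z≡y
  ... | no _ | there z∈ys = there (∈-remove ys z∈ys z≢x)

  Unique-⊆⇒length≤ : ∀ {xs} ys → Unique xs → (∀ {z} → z ∈ xs → z ∈ ys) → length xs ≤ length ys
  Unique-⊆⇒length≤ {[]} ys _ _ = z≤n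
  Unique-⊆⇒length≤ {x ∷ xs} ys (x∉xs ∷ xs!) xs⊆ys =
    subst (suc (length xs) ≤_) (length-remove ys (xs⊆ys (here refl)))
      (s≤s (Unique-⊆⇒length≤ (remove x ys) xs! λ z∈xs →
        ∈-remove ys (xs⊆ys (there z∈xs)) λ { refl → All.lookup x∉xs z∈xs refl }))

Card-mono : {A : Set} → DecidableEquality A → {P Q : A → Set} {c c' : ℕ} →
  Card P c → Card Q c' → (∀ x → P x → Q x) → c ≤ c'
Card-mono _≟_ (xs , xs! , xs⇔ , refl) (ys , _ , ys⇔ , refl) P⇒Q =
  Unique-⊆⇒length≤ _≟_ ys xs! λ {z} z∈xs → from (ys⇔ z) (P⇒Q z (to (xs⇔ z) z∈xs))

Card-exists : ∀ {n} (P : Fin n → Set) → Decidable P → ∃ λ c → Card P c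
Card-exists {n} P P? = length xs , xs , Unique.filter⁺ P? (Unique.allFin⁺ n) ,
  (λ x → mk⇔ (λ x∈ → proj₂ (∈-filter⁻ P? {xs = allFin n} x∈)) (∈-filter⁺ P? (∈-allFin x))) , refl
  where xs = filter P? (allFin n)

-- deg H v and every row sum of edges H are count𝔹 sums by definition.
count𝔹 : {A : Set} → (A → Bool) → List A → ℕ
count𝔹 b xs = sum (map (λ x → if b x then 1 else 0) xs)

count𝔹-++ : {A : Set} (b : A → Bool) (xs ys : List A) → count𝔹 b (xs ++ ys) ≡ count𝔹 b xs + count𝔹 b ys
count𝔹-++ b [] ys = refl
count𝔹-++ b (x ∷ xs) ys = trans (cong ((if b x then 1 else 0) +_) (count𝔹-++ b xs ys))
  (sym (+-assoc (if b x then 1 else 0) (count𝔹 b xs) (count𝔹 b ys)))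

count𝔹-map : {A B : Set} (b : B → Bool) (f : A → B) (xs : List A) → count𝔹 b (map f xs) ≡ count𝔹 (λ x → b (f x)) xs
count𝔹-map b f [] = refl
count𝔹-map b f (x ∷ xs) = cong ((if b (f x) then 1 else 0) +_) (count𝔹-map b f xs)

count𝔹-cartesianProduct : {A B : Set} (b : A → B → Bool) (xs : List A) (ys : List B) →
  sum (map (λ x → count𝔹 (b x) ys) xs) ≡ count𝔹 (λ p → b (proj₁ p) (proj₂ p)) (cartesianProduct xs ys)
count𝔹-cartesianProduct b [] ys = refl
count𝔹-cartesianProduct b (x ∷ xs) ys = begin
  count𝔹 (b x) ys + sum (map (λ x → count𝔹 (b x) ys) xs)
    ≡⟨ cong₂ _+_ (sym (count𝔹-map b′ (x ,_) ys)) (count𝔹-cartesianProduct b xs ys) ⟩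
  count𝔹 b′ (map (x ,_) ys) + count𝔹 b′ (cartesianProduct xs ys)
    ≡⟨ sym (count𝔹-++ b′ (map (x ,_) ys) (cartesianProduct xs ys)) ⟩
  count𝔹 b′ (cartesianProduct (x ∷ xs) ys) ∎
  where
  open ≡-Reasoning
  b′ = λ p → b (proj₁ p) (proj₂ p)

count𝔹≡length-filter : {A : Set} (b : A → Bool) (xs : List A) →
  count𝔹 b xs ≡ length (filter (λ x → b x Bool.≟ true) xs)
count𝔹≡length-filter b [] = refl
count𝔹≡length-filter b (x ∷ xs) with b x
... | true = cong suc (count𝔹≡length-filter b xs)
... | false = count𝔹≡length-filter b xs

Unique-⊆⇒length≤count𝔹 : {A : Set} → DecidableEquality A → (b : A → Bool) {xs : List A} (ys : List A) →
  Unique xs → (∀ {z} → z ∈ xs → z ∈ ys × b z ≡ true) → length xs ≤ count𝔹 b ys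
Unique-⊆⇒length≤count𝔹 _≟_ b ys xs! xs⊆ = subst (_ ≤_) (sym (count𝔹≡length-filter b ys))
  (Unique-⊆⇒length≤ _≟_ _ xs! λ z∈ → ∈-filter⁺ (λ x → b x Bool.≟ true) (proj₁ (xs⊆ z∈)) (proj₂ (xs⊆ z∈)))

count𝔹≡0 : {A : Set} (b : A → Bool) (xs : List A) → count𝔹 b xs ≡ 0 → ∀ {x} → x ∈ xs → b x ≡ false
count𝔹≡0 b (y ∷ xs) c≡0 x∈ with b y in by | x∈
... | false | here refl = by
... | false | there x∈xs = count𝔹≡0 b xs c≡0 x∈xs

count𝔹≡1 : {A : Set} (b : A → Bool) (xs : List A) → count𝔹 b xs ≡ 1 →
  ∃ λ y → b y ≡ true × (∀ {x} → x ∈ xs → b x ≡ true → x ≡ y) × y ∈ xs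
count𝔹≡1 b (y ∷ xs) c≡1 with b y in by
... | true = y , by , only , here refl
  where
  only : ∀ {x} → x ∈ y ∷ xs → b x ≡ true → x ≡ y
  only (here x≡y) _ = x≡y
  only (there x∈xs) bx with () ← trans (sym bx) (count𝔹≡0 b xs (suc-injective c≡1) x∈xs)
... | false with count𝔹≡1 b xs c≡1
... | z , bz , only , z∈ = z , bz , only′ , there z∈
  where
  only′ : ∀ {x} → x ∈ y ∷ xs → b x ≡ true → x ≡ z
  only′ (here refl) bx with () ← trans (sym bx) by
  only′ (there x∈xs) bx = only x∈xs bx

count𝔹≡2 : {A : Set} (b : A → Bool) (xs : List A) → Unique xs → count𝔹 b xs ≡ 2 →
  ∃ λ y₁ → ∃ λ y₂ → y₁ ≢ y₂ × b y₁ ≡ true × b y₂ ≡ true × (∀ {x} → x ∈ xs → b x ≡ true → x ≡ y₁ ⊎ x ≡ y₂)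
count𝔹≡2 b (y ∷ xs) (y∉xs ∷ xs!) c≡2 with b y in by
... | true with count𝔹≡1 b xs (suc-injective c≡2)
... | z , bz , only , z∈xs = y , z , (λ { refl → All.lookup y∉xs z∈xs refl }) , by , bz , only′
  where
  only′ : ∀ {x} → x ∈ y ∷ xs → b x ≡ true → x ≡ y ⊎ x ≡ z
  only′ (here x≡y) _ = inj₁ x≡y
  only′ (there x∈xs) bx = inj₂ (only x∈xs bx)
count𝔹≡2 b (y ∷ xs) (_ ∷ xs!) c≡2 | false with count𝔹≡2 b xs xs! c≡2
... | y₁ , y₂ , y₁≢y₂ , b₁ , b₂ , only = y₁ , y₂ , y₁≢y₂ , b₁ , b₂ , only′
  where
  only′ : ∀ {x} → x ∈ y ∷ xs → b x ≡ true → x ≡ y₁ ⊎ x ≡ y₂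
  only′ (here refl) bx with () ← trans (sym bx) by
  only′ (there x∈xs) bx = only x∈xs bx

module _ {n : ℕ} where

  deg≡0⇒nonadjacent : ∀ (H : Graph n) v → deg H v ≡ 0 → ∀ u → H v u ≡ false
  deg≡0⇒nonadjacent H v d≡0 u = count𝔹≡0 (H v) (allFin n) d≡0 (∈-allFin u)

  record TwoNeighbours (H : Graph n) (v : Fin n) : Set where
    field
      u₁ u₂ : Fin n
      u₁≢u₂ : u₁ ≢ u₂
      adj₁ : H v u₁ ≡ true
      adj₂ : H v u₂ ≡ true
      only : ∀ u → H v u ≡ true → u ≡ u₁ ⊎ u ≡ u₂

  deg≡2⇒TwoNeighbours : ∀ (H : Graph n) v → deg H v ≡ 2 → TwoNeighbours H v
  deg≡2⇒TwoNeighbours H v d≡2 with count𝔹≡2 (H v) (allFin n) (Unique.allFin⁺ n) d≡2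
  ... | u₁ , u₂ , u₁≢u₂ , adj₁ , adj₂ , only = record
    { u₁ = u₁ ; u₂ = u₂ ; u₁≢u₂ = u₁≢u₂ ; adj₁ = adj₁ ; adj₂ = adj₂ ; only = λ u adj → only (∈-allFin u) adj }

  Unique-edges≤edges : ∀ (H : Graph n) (xs : List (Fin n × Fin n)) → Unique xs →
    (∀ {e} → e ∈ xs → toℕ (proj₁ e) < toℕ (proj₂ e) × H (proj₁ e) (proj₂ e) ≡ true) →
    length xs ≤ edges H
  Unique-edges≤edges H xs xs! xs⊆ =
    subst (length xs ≤_) (sym (count𝔹-cartesianProduct ordered (allFin n) (allFin n)))
      (Unique-⊆⇒length≤count𝔹 (≡-dec Fin._≟_ Fin._≟_) _ _ xs! λ {e} e∈ →
        ∈-cartesianProduct⁺ (∈-allFin (proj₁ e)) (∈-allFin (proj₂ e)) ,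
        cong₂ _∧_ (dec-true (_ ℕ.<? _) (proj₁ (xs⊆ e∈))) (proj₂ (xs⊆ e∈)))
    where
    ordered : Fin n → Fin n → Bool
    ordered i j = does (toℕ i ℕ.<? toℕ j) ∧ H i j

-- Cyclic order on Fin m

module _ (d : ℕ) .{{_ : NonZero d}} where

  [m%d+n]%d≡[m+n]%d : ∀ m n → (m % d + n) % d ≡ (m + n) % d
  [m%d+n]%d≡[m+n]%d m n = begin
    (m % d + n) % d           ≡⟨ %-distribˡ-+ (m % d) n d ⟩
    (m % d % d + n % d) % d   ≡⟨ cong (λ r → (r + n % d) % d) (m%n%n≡m%n m d) ⟩
    (m % d + n % d) % d       ≡⟨ sym (%-distribˡ-+ m n d) ⟩
    (m + n) % d               ∎
    where open ≡-Reasoning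

  [m+n%d]%d≡[m+n]%d : ∀ m n → (m + n % d) % d ≡ (m + n) % d
  [m+n%d]%d≡[m+n]%d m n = begin
    (m + n % d) % d  ≡⟨ cong (_% d) (+-comm m (n % d)) ⟩
    (n % d + m) % d  ≡⟨ [m%d+n]%d≡[m+n]%d n m ⟩
    (n + m) % d      ≡⟨ cong (_% d) (+-comm n m) ⟩
    (m + n) % d      ∎
    where open ≡-Reasoning

  [m+n+[d∸m%d]]%d≡n%d : ∀ m n → (m + n + (d ∸ m % d)) % d ≡ n % d
  [m+n+[d∸m%d]]%d≡n%d m n = begin
    (m + n + (d ∸ r)) % d              ≡⟨ cong (λ m′ → (m′ + n + (d ∸ r)) % d) (m≡m%n+[m/n]*n m d) ⟩
    (r + q * d + n + (d ∸ r)) % d      ≡⟨ cong (_% d) (reorder r (q * d) n (d ∸ r)) ⟩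
    (n + (q * d + (r + (d ∸ r)))) % d  ≡⟨ cong (λ s → (n + (q * d + s)) % d) (m+[n∸m]≡n (m%n≤n m d)) ⟩
    (n + (q * d + d)) % d              ≡⟨ cong (λ s → (n + s) % d) (+-comm (q * d) d) ⟩
    (n + suc q * d) % d                ≡⟨ [m+kn]%n≡m%n n (suc q) d ⟩
    n % d                              ∎
    where
    open ≡-Reasoning
    r = m % d
    q = m / d
    reorder : ∀ a b c e → a + b + c + e ≡ c + (b + (a + e))
    reorder = solve-∀

  +-cancelˡ-% : ∀ m n o → (m + n) % d ≡ (m + o) % d → n % d ≡ o % d
  +-cancelˡ-% m n o eq = begin
    n % d                          ≡⟨ sym ([m+n+[d∸m%d]]%d≡n%d m n) ⟩
    (m + n + t) % d                ≡⟨ sym ([m%d+n]%d≡[m+n]%d (m + n) t) ⟩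
    ((m + n) % d + t) % d          ≡⟨ cong (λ s → (s + t) % d) eq ⟩
    ((m + o) % d + t) % d          ≡⟨ [m%d+n]%d≡[m+n]%d (m + o) t ⟩
    (m + o + t) % d                ≡⟨ [m+n+[d∸m%d]]%d≡n%d m o ⟩
    o % d                          ∎
    where
    open ≡-Reasoning
    t = d ∸ m % d

module _ {m : ℕ} where

  private
    M = suc m

  toℕ%≡toℕ : ∀ (i : Fin M) → toℕ i % M ≡ toℕ i
  toℕ%≡toℕ i = m<n⇒m%n≡m (toℕ<n i)

  fin% : ℕ → Fin M
  fin% x = fromℕ< (m%n<n x M)

  toℕ-fin% : ∀ x → toℕ (fin% x) ≡ x % M
  toℕ-fin% x = toℕ-fromℕ< (m%n<n x M)

  CycAdj⇔≡suc% : ∀ (i j : Fin M) → CycAdj M i j ⇔ (toℕ j ≡ suc (toℕ i) % M)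
  CycAdj⇔≡suc% i j = mk⇔ ⇒ ⇐
    where
    ⇒ : CycAdj M i j → toℕ j ≡ suc (toℕ i) % M
    ⇒ (inj₁ i+1≡j) = sym (trans (m<n⇒m%n≡m (subst (_< M) (sym i+1≡j) (toℕ<n j))) i+1≡j)
    ⇒ (inj₂ (i+1≡M , j≡0)) = trans j≡0 (sym (trans (cong (_% M) i+1≡M) (n%n≡0 M)))
    ⇐ : toℕ j ≡ suc (toℕ i) % M → CycAdj M i j
    ⇐ j≡ with suc (toℕ i) <? M
    ... | yes i+1<M = inj₁ (sym (trans j≡ (m<n⇒m%n≡m i+1<M)))
    ... | no i+1≮M = inj₂ (i+1≡M , trans j≡ (trans (cong (_% M) i+1≡M) (n%n≡0 M)))
      where i+1≡M = ≤-antisym (toℕ<n i) (≮⇒≥ i+1≮M)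

  next : Fin M → Fin M
  next i = fin% (suc (toℕ i))

  prev : Fin M → Fin M
  prev i = fin% (toℕ i + m)

  CycAdj-next : ∀ i → CycAdj M i (next i)
  CycAdj-next i = from (CycAdj⇔≡suc% i (next i)) (toℕ-fin% (suc (toℕ i)))

  CycAdj-prev : ∀ i → CycAdj M (prev i) i
  CycAdj-prev i = from (CycAdj⇔≡suc% (prev i) i) (sym (begin
    suc (toℕ (prev i)) % M        ≡⟨ cong (λ s → suc s % M) (toℕ-fin% (toℕ i + m)) ⟩
    (1 + (toℕ i + m) % M) % M     ≡⟨ [m+n%d]%d≡[m+n]%d M 1 (toℕ i + m) ⟩
    suc (toℕ i + m) % M           ≡⟨ cong (_% M) (sym (+-suc (toℕ i) m)) ⟩
    (toℕ i + M) % M               ≡⟨ [m+n]%n≡m%n (toℕ i) M ⟩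
    toℕ i % M                     ≡⟨ toℕ%≡toℕ i ⟩
    toℕ i                         ∎))
    where open ≡-Reasoning

  CycAdj-functional : ∀ {i j j′} → CycAdj M i j → CycAdj M i j′ → j ≡ j′
  CycAdj-functional {i} {j} {j′} ij ij′ =
    toℕ-injective (trans (to (CycAdj⇔≡suc% i j) ij) (sym (to (CycAdj⇔≡suc% i j′) ij′)))

  CycAdj-injective : ∀ {i i′ j} → CycAdj M i j → CycAdj M i′ j → i ≡ i′
  CycAdj-injective {i} {i′} {j} ij i′j = toℕ-injective (begin
    toℕ i       ≡⟨ sym (toℕ%≡toℕ i) ⟩
    toℕ i % M   ≡⟨ +-cancelˡ-% M 1 (toℕ i) (toℕ i′)
                     (trans (sym (to (CycAdj⇔≡suc% i j) ij)) (to (CycAdj⇔≡suc% i′ j) i′j)) ⟩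
    toℕ i′ % M  ≡⟨ toℕ%≡toℕ i′ ⟩
    toℕ i′      ∎)
    where open ≡-Reasoning

  CycAdj-asym : 3 ≤ M → ∀ {i j} → CycAdj M i j → CycAdj M j i → ⊥
  CycAdj-asym 3≤M {i} {j} ij ji = 1+n≢0 (trans (sym (m<n⇒m%n≡m 3≤M)) 2≡0)
    where
    open ≡-Reasoning
    2+i≡0+i : (toℕ i + 2) % M ≡ (toℕ i + 0) % M
    2+i≡0+i = begin
      (toℕ i + 2) % M            ≡⟨ cong (_% M) (+-comm (toℕ i) 2) ⟩
      (1 + suc (toℕ i)) % M      ≡⟨ sym ([m+n%d]%d≡[m+n]%d M 1 (suc (toℕ i))) ⟩
      (1 + suc (toℕ i) % M) % M  ≡⟨ cong (λ s → suc s % M) (sym (to (CycAdj⇔≡suc% i j) ij)) ⟩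
      suc (toℕ j) % M            ≡⟨ sym (to (CycAdj⇔≡suc% j i) ji) ⟩
      toℕ i                      ≡⟨ sym (toℕ%≡toℕ i) ⟩
      toℕ i % M                  ≡⟨ cong (_% M) (sym (+-identityʳ (toℕ i))) ⟩
      (toℕ i + 0) % M            ∎
    2≡0 : 2 % M ≡ 0 % M
    2≡0 = +-cancelˡ-% M (toℕ i) 2 0 2+i≡0+i

  next≢prev : 3 ≤ M → ∀ i → next i ≢ prev i
  next≢prev 3≤M i next≡prev =
    CycAdj-asym 3≤M (CycAdj-next i) (subst (λ j → CycAdj M j i) (sym next≡prev) (CycAdj-prev i))

module Rotation {m : ℕ} (j₀ : Fin (suc m)) where

  private
    M = suc m
    a = toℕ j₀

  rotate : Fin M → Fin M
  rotate i = fin% (a + toℕ i)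

  toℕ-rotate : ∀ i → toℕ (rotate i) ≡ (a + toℕ i) % M
  toℕ-rotate i = toℕ-fin% (a + toℕ i)

  rotate-zero : rotate Fin.zero ≡ j₀
  rotate-zero = toℕ-injective (trans (toℕ-rotate Fin.zero) (trans (cong (_% M) (+-identityʳ a)) (toℕ%≡toℕ j₀)))

  rotate-injective : Injective _≡_ _≡_ rotate
  rotate-injective {i} {i′} eq = toℕ-injective (begin
    toℕ i       ≡⟨ sym (toℕ%≡toℕ i) ⟩
    toℕ i % M   ≡⟨ +-cancelˡ-% M a (toℕ i) (toℕ i′) (trans (sym (toℕ-rotate i)) (trans (cong toℕ eq) (toℕ-rotate i′))) ⟩
    toℕ i′ % M  ≡⟨ toℕ%≡toℕ i′ ⟩
    toℕ i′      ∎)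
    where open ≡-Reasoning

  rotate-surjective : ∀ k → ∃ λ i → rotate i ≡ k
  rotate-surjective k = fin% x , toℕ-injective (begin
    toℕ (rotate (fin% x))        ≡⟨ toℕ-rotate (fin% x) ⟩
    (a + toℕ (fin% x)) % M       ≡⟨ cong (λ s → (a + s) % M) (toℕ-fin% x) ⟩
    (a + x % M) % M              ≡⟨ [m+n%d]%d≡[m+n]%d M a x ⟩
    (a + x) % M                  ≡⟨ cong (_% M) (sym (+-assoc a (toℕ k) _)) ⟩
    (a + toℕ k + (M ∸ a % M)) % M ≡⟨ [m+n+[d∸m%d]]%d≡n%d M a (toℕ k) ⟩
    toℕ k % M                    ≡⟨ toℕ%≡toℕ k ⟩
    toℕ k                        ∎)
    where
    open ≡-Reasoning
    x = toℕ k + (M ∸ a % M)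

  rotate-CycAdj : ∀ i j → CycAdj M (rotate i) (rotate j) ⇔ CycAdj M i j
  rotate-CycAdj i j = mk⇔
    (λ adj → from (CycAdj⇔≡suc% i j) (trans (sym (toℕ%≡toℕ j))
       (+-cancelˡ-% M a (toℕ j) (suc (toℕ i)) (trans (sym (toℕ-rotate j)) (trans (to (CycAdj⇔≡suc% _ _) adj) shift)))))
    (λ adj → from (CycAdj⇔≡suc% (rotate i) (rotate j)) (begin
       toℕ (rotate j)          ≡⟨ toℕ-rotate j ⟩
       (a + toℕ j) % M         ≡⟨ cong (λ s → (a + s) % M) (to (CycAdj⇔≡suc% i j) adj) ⟩
       (a + suc (toℕ i) % M) % M ≡⟨ [m+n%d]%d≡[m+n]%d M a (suc (toℕ i)) ⟩
       (a + suc (toℕ i)) % M   ≡⟨ sym shift ⟩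
       suc (toℕ (rotate i)) % M ∎))
    where
    open ≡-Reasoning
    shift : suc (toℕ (rotate i)) % M ≡ (a + suc (toℕ i)) % M
    shift = begin
      suc (toℕ (rotate i)) % M  ≡⟨ cong (λ s → suc s % M) (toℕ-rotate i) ⟩
      (1 + (a + toℕ i) % M) % M ≡⟨ [m+n%d]%d≡[m+n]%d M 1 (a + toℕ i) ⟩
      suc (a + toℕ i) % M       ≡⟨ cong (_% M) (sym (+-suc a (toℕ i))) ⟩
      (a + suc (toℕ i)) % M     ∎

-- Components

module _ {n : ℕ} where

  Symmetric : Graph n → Set
  Symmetric H = ∀ u v → H u v ≡ H v u

  Reach-trans : ∀ {H : Graph n} {u v w} → Reach H u v → Reach H v w → Reach H u w
  Reach-trans r here = r
  Reach-trans r (step r′ e) = step (Reach-trans r r′) e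

  Reach-sym : ∀ {H : Graph n} → Symmetric H → ∀ {u v} → Reach H u v → Reach H v u
  Reach-sym sym-H here = here
  Reach-sym sym-H (step {v} {w} r e) = Reach-trans (step here (trans (sym-H w v) e)) (Reach-sym sym-H r)

  Reach-mono : ∀ {H H′ : Graph n} → (∀ u v → H u v ≡ true → H′ u v ≡ true) → ∀ {u v} → Reach H u v → Reach H′ u v
  Reach-mono H⊆H′ here = here
  Reach-mono H⊆H′ (step {v} {w} r e) = step (Reach-mono H⊆H′ r) (H⊆H′ v w e)

  Enumerates : Graph n → Fin n → ℕ → Set
  Enumerates H v m = Σ (Fin m → Fin n) λ f → Injective _≡_ _≡_ f × (∀ u → Reach H v u ⇔ (∃ λ i → f i ≡ u))

  IsPathComp⇒Enumerates : ∀ {H v m} → IsPathComp H v m → Enumerates H v m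
  IsPathComp⇒Enumerates (f , f-inj , f-onto , _) = f , f-inj , f-onto

  IsCycleComp⇒Enumerates : ∀ {H v m} → IsCycleComp H v m → Enumerates H v m
  IsCycleComp⇒Enumerates (_ , f , f-inj , f-onto , _) = f , f-inj , f-onto

  Enumerates-≤ : ∀ {H v m m′} → Enumerates H v m → Enumerates H v m′ → m ≤ m′
  Enumerates-≤ {m = m} {m′} (f , f-inj , f-onto) (g , _ , g-onto) = injective⇒≤ {f = index} index-inj
    where
    index-spec : ∀ i → ∃ λ j → g j ≡ f i
    index-spec i = to (g-onto (f i)) (from (f-onto (f i)) (i , refl))
    index : Fin m → Fin m′
    index i = proj₁ (index-spec i)
    index-inj : Injective _≡_ _≡_ index
    index-inj {i} {j} eq = f-inj (trans (sym (proj₂ (index-spec i))) (trans (cong g eq) (proj₂ (index-spec j))))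

  Enumerates-≡ : ∀ {H v m m′} → Enumerates H v m → Enumerates H v m′ → m ≡ m′
  Enumerates-≡ e e′ = ≤-antisym (Enumerates-≤ e e′) (Enumerates-≤ e′ e)

  Enumerates⇒Reach? : ∀ {H v m} → Enumerates H v m → ∀ u → Dec (Reach H v u)
  Enumerates⇒Reach? (f , _ , f-onto) u = map′ (from (f-onto u)) (to (f-onto u)) (any? λ i → f i Fin.≟ u)

  Reach? : ∀ {G H : Graph n} → PathCycleCover G H → ∀ v u → Dec (Reach H v u)
  Reach? (_ , _ , comp) v with comp v
  ... | inj₁ (_ , path) = Enumerates⇒Reach? (IsPathComp⇒Enumerates path)
  ... | inj₂ (_ , cycle) = Enumerates⇒Reach? (IsCycleComp⇒Enumerates cycle)

  IsCycleComp-transport : ∀ {H} → Symmetric H → ∀ {v w m} → Reach H v w → IsCycleComp H v m → IsCycleComp H w m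
  IsCycleComp-transport {H} sym-H {w = w} v⇝w (3≤m , f , f-inj , f-onto , f-adj) = 3≤m , f , f-inj , onto , f-adj
    where
    onto : ∀ u → Reach H w u ⇔ (∃ λ i → f i ≡ u)
    onto u = mk⇔ (λ w⇝u → to (f-onto u) (Reach-trans v⇝w w⇝u))
                 (λ i → Reach-trans (Reach-sym sym-H v⇝w) (from (f-onto u) i))

  InShort-transport : ∀ {H} → Symmetric H → ∀ {v w} → Reach H v w → InShort H v → InShort H w
  InShort-transport sym-H v⇝w (m , cycle , short) = m , IsCycleComp-transport sym-H v⇝w cycle , short

  -- In a cycle the two neighbours of a vertex are distinct, in a path the neighbours of an endpoint are not.
  IsPathComp⇒¬IsCycleComp : ∀ {H} → Symmetric H → ∀ {v m m′} → IsPathComp H v m → ¬ IsCycleComp H v m′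
  IsPathComp⇒¬IsCycleComp {H} sym-H {v} {m} path@(p , _ , p-onto , p-adj) cycle@(3≤m′@(s≤s _) , g , g-inj , g-onto , g-adj) =
    next≢prev 3≤m′ j (g-inj (trans (sym (proj₂ next∈p)) (trans (cong p same-index) (proj₂ prev∈p))))
    where
    0<m : 0 < m
    0<m = subst (0 <_) (sym (Enumerates-≡ (IsPathComp⇒Enumerates path) (IsCycleComp⇒Enumerates cycle)))
      (≤-trans (s≤s z≤n) 3≤m′)
    start : Fin m
    start = fromℕ< 0<m
    start∈g : ∃ λ j → g j ≡ p start
    start∈g = to (g-onto (p start)) (from (p-onto (p start)) (start , refl))
    j = proj₁ start∈g
    v⇝gj : Reach H v (g j)
    v⇝gj = from (g-onto (g j)) (j , refl)
    to-next : H (g j) (g (next j)) ≡ true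
    to-next = from (g-adj j (next j)) (inj₁ (CycAdj-next j))
    to-prev : H (g j) (g (prev j)) ≡ true
    to-prev = from (g-adj j (prev j)) (inj₂ (CycAdj-prev j))
    next∈p = to (p-onto (g (next j))) (step v⇝gj to-next)
    prev∈p = to (p-onto (g (prev j))) (step v⇝gj to-prev)
    neighbour-of-start : ∀ {w} (w∈p : ∃ λ i → p i ≡ w) → H (g j) w ≡ true → toℕ (proj₁ w∈p) ≡ 1
    neighbour-of-start (i , refl) adj
      with to (p-adj start i) (subst (λ z → H z (p i) ≡ true) (proj₂ start∈g) adj)
    ... | inj₁ start+1≡i = trans (sym start+1≡i) (cong suc (toℕ-fromℕ< 0<m))
    ... | inj₂ i+1≡start with () ← trans i+1≡start (toℕ-fromℕ< 0<m)
    same-index : proj₁ next∈p ≡ proj₁ prev∈p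
    same-index = toℕ-injective (trans (neighbour-of-start next∈p to-next) (sym (neighbour-of-start prev∈p to-prev)))

  InShort? : ∀ {G H : Graph n} → PathCycleCover G H → ∀ v → Dec (InShort H v)
  InShort? {H = H} ((sym-H , _) , _ , comp) v with comp v
  ... | inj₁ (_ , path) = no λ (_ , cycle , _) → IsPathComp⇒¬IsCycleComp sym-H path cycle
  ... | inj₂ (m , cycle) with m ℕ.≟ 4 | m ℕ.≟ 5
  ... | yes m≡4 | _ = yes (m , cycle , inj₁ m≡4)
  ... | no _ | yes m≡5 = yes (m , cycle , inj₂ m≡5)
  ... | no m≢4 | no m≢5 = no λ (m′ , cycle′ , short) → not-short short
    (Enumerates-≡ (IsCycleComp⇒Enumerates cycle) (IsCycleComp⇒Enumerates cycle′))
    where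
    not-short : ∀ {m′} → m′ ≡ 4 ⊎ m′ ≡ 5 → m ≢ m′
    not-short (inj₁ refl) = m≢4
    not-short (inj₂ refl) = m≢5

-- Stinginess

module _ {n : ℕ} where

  removeEdge-cases : ∀ (W : Graph n) a b u w →
    removeEdge W a b u w ≡ W u w ⊎ (u ≡ a × w ≡ b) ⊎ (u ≡ b × w ≡ a)
  removeEdge-cases W a b u w with u Fin.≟ a | w Fin.≟ b | u Fin.≟ b | w Fin.≟ a
  ... | yes u≡a | yes w≡b | _ | _ = inj₂ (inj₁ (u≡a , w≡b))
  ... | _ | _ | yes u≡b | yes w≡a = inj₂ (inj₂ (u≡b , w≡a))
  ... | yes _ | no _ | yes _ | no _ = inj₁ refl
  ... | yes _ | no _ | no _ | _ = inj₁ refl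
  ... | no _ | _ | yes _ | no _ = inj₁ refl
  ... | no _ | _ | no _ | _ = inj₁ refl

  removeEdge-other : ∀ (W : Graph n) {a b u w} → ¬ (u ≡ a × w ≡ b) → ¬ (u ≡ b × w ≡ a) →
    removeEdge W a b u w ≡ W u w
  removeEdge-other W {a} {b} {u} {w} ≢ab ≢ba with removeEdge-cases W a b u w
  ... | inj₁ eq = eq
  ... | inj₂ (inj₁ ≡ab) = ⊥-elim (≢ab ≡ab)
  ... | inj₂ (inj₂ ≡ba) = ⊥-elim (≢ba ≡ba)

  Stingy : Graph n → Graph n → Set
  Stingy F W = ∀ (u v : Fin n) → W u v ≡ true → ∀ c c′ →
    Weight F W c → Weight F (removeEdge W u v) c′ → c′ < c

  Pendant : Graph n → Graph n → Fin n → Fin n → Set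
  Pendant F W a b = InShort F b × (∀ u → Reach F b u → ∀ w → W u w ≡ true → u ≡ b × w ≡ a)

  module _ {G F : Graph n} (pcc-F : PathCycleCover G F) where

    private
      sym-F : Symmetric F
      sym-F = proj₁ (proj₁ pcc-F)

    Weight-exists : ∀ W → ∃ λ c → Weight F W c
    Weight-exists W = Card-exists _ λ s → ShortRep? s ×-dec Saturated? s
      where
      ShortRep? : ∀ s → Dec (ShortRep F s)
      ShortRep? s = InShort? pcc-F s ×-dec all? λ u → Reach? pcc-F s u →-dec (toℕ s ℕ.≤? toℕ u)
      Saturated? : ∀ s → Dec (Saturated F W s)
      Saturated? s = any? λ u → Reach? pcc-F s u ×-dec any? λ w → W u w Bool.≟ true

    ¬Pendant⇒other-edge : ∀ {W a b} → InShort F b → ¬ Pendant F W a b →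
      ∃ λ u → ∃ λ w → Reach F b u × W u w ≡ true × ¬ (u ≡ b × w ≡ a)
    ¬Pendant⇒other-edge {W} {a} {b} b-short ¬pendant = u , w , b⇝u , uw , ¬ba
      where
      Only-ba : Fin n → Fin n → Set
      Only-ba u w = W u w ≡ true → u ≡ b × w ≡ a
      Only-ba? : ∀ u w → Dec (Only-ba u w)
      Only-ba? u w = (W u w Bool.≟ true) →-dec ((u Fin.≟ b) ×-dec (w Fin.≟ a))
      u-bad = ¬∀⟶∃¬ n (λ u → Reach F b u → ∀ w → Only-ba u w) (λ u → Reach? pcc-F b u →-dec all? (Only-ba? u))
        λ all-ok → ¬pendant (b-short , all-ok)
      u = proj₁ u-bad
      b⇝u : Reach F b u
      b⇝u with Reach? pcc-F b u
      ... | yes b⇝u = b⇝u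
      ... | no ¬b⇝u = ⊥-elim (proj₂ u-bad λ b⇝u → ⊥-elim (¬b⇝u b⇝u))
      w-bad = ¬∀⟶∃¬ n (Only-ba u) (Only-ba? u) λ all-ok → proj₂ u-bad λ _ → all-ok
      w = proj₁ w-bad
      uw : W u w ≡ true
      uw with W u w Bool.≟ true
      ... | yes uw = uw
      ... | no ¬uw = ⊥-elim (proj₂ w-bad λ uw → ⊥-elim (¬uw uw))
      ¬ba : ¬ (u ≡ b × w ≡ a)
      ¬ba ba = proj₂ w-bad λ _ → ba

    Pendant? : ∀ W a b → Dec (Pendant F W a b)
    Pendant? W a b = InShort? pcc-F b ×-dec all? λ u → Reach? pcc-F b u →-dec all? λ w →
      (W u w Bool.≟ true) →-dec ((u Fin.≟ b) ×-dec (w Fin.≟ a))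

    -- If a has two W-neighbours b and b′, then removing {a, b} keeps a's cycle saturated, so by stinginess
    -- it must unsaturate b's cycle: that cycle is short and {a, b} is its only W-edge.
    Stingy⇒Pendant : ∀ {W} → (∀ {u v} → W u v ≡ true → ¬ Reach F u v) → Stingy F W →
      ∀ {a b b′} → W a b ≡ true → W a b′ ≡ true → b ≢ b′ → Pendant F W a b
    Stingy⇒Pendant {W} W-between stingy {a} {b} {b′} ab ab′ b≢b′ with Pendant? W a b
    ... | yes pendant = pendant
    ... | no ¬pendant = ⊥-elim (<⇒≱ (stingy a b ab c c′ weight weight′) (Card-mono Fin._≟_ weight weight′ stays-saturated))
      where
      W′ = removeEdge W a b
      c = proj₁ (Weight-exists W)
      weight = proj₂ (Weight-exists W)
      c′ = proj₁ (Weight-exists W′)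
      weight′ = proj₂ (Weight-exists W′)
      a≢b : a ≢ b
      a≢b a≡b = W-between ab (subst (Reach F a) a≡b here)
      stays-saturated : ∀ s → ShortRep F s × Saturated F W s → ShortRep F s × Saturated F W′ s
      stays-saturated s (rep , u , s⇝u , w , uw) with removeEdge-cases W a b u w
      ... | inj₁ kept = rep , u , s⇝u , w , trans kept uw
      ... | inj₂ (inj₁ (refl , refl)) =
        rep , a , s⇝u , b′ , trans (removeEdge-other W (λ (_ , b′≡b) → b≢b′ (sym b′≡b)) (λ (a≡b , _) → a≢b a≡b)) ab′
      ... | inj₂ (inj₂ (refl , refl)) with ¬Pendant⇒other-edge (InShort-transport sym-F s⇝u (proj₁ rep)) ¬pendant
      ... | u′ , w′ , b⇝u′ , u′w′ , ¬ba = rep , u′ , Reach-trans s⇝u b⇝u′ , w′ ,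
        trans (removeEdge-other W ¬ab ¬ba) u′w′
        where
        ¬ab : ¬ (u′ ≡ a × w′ ≡ b)
        ¬ab (refl , _) = W-between ab (Reach-sym sym-F b⇝u′)

-- Paths

Adjacentℕ : ℕ → ℕ → Set
Adjacentℕ x y = suc x ≡ y ⊎ suc y ≡ x

Consecutive : ∀ {L} → Fin L → Fin L → Set
Consecutive i j = Adjacentℕ (toℕ i) (toℕ j)

Adjacentℕ-sym : ∀ {x y} → Adjacentℕ x y → Adjacentℕ y x
Adjacentℕ-sym (inj₁ eq) = inj₂ eq
Adjacentℕ-sym (inj₂ eq) = inj₁ eq

Adjacentℕ-+ˡ : ∀ k {x y} → Adjacentℕ (k + x) (k + y) ⇔ Adjacentℕ x y
Adjacentℕ-+ˡ k {x} {y} = mk⇔ (Sum.map (cancel x y) (cancel y x)) (Sum.map (shift x y) (shift y x))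
  where
  shift : ∀ x y → suc x ≡ y → suc (k + x) ≡ k + y
  shift x y eq = trans (sym (+-suc k x)) (cong (k +_) eq)
  cancel : ∀ x y → suc (k + x) ≡ k + y → suc x ≡ y
  cancel x y eq = +-cancelˡ-≡ k (suc x) y (trans (+-suc k x) eq)

Adjacentℕ-across : ∀ {L₁ x y} → x < L₁ → Adjacentℕ x (L₁ + y) ⇔ (suc x ≡ L₁ × y ≡ 0)
Adjacentℕ-across {L₁} {x} {y} x<L₁ = mk⇔ ⇒ ⇐
  where
  ⇒ : Adjacentℕ x (L₁ + y) → suc x ≡ L₁ × y ≡ 0
  ⇒ (inj₁ x+1≡L₁+y) = trans x+1≡L₁+y (trans (cong (L₁ +_) y≡0) (+-identityʳ L₁)) , y≡0
    where
    y≡0 : y ≡ 0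
    y≡0 = n≤0⇒n≡0 (+-cancelˡ-≤ L₁ y 0 (subst (_≤ L₁ + 0) x+1≡L₁+y (subst (suc x ≤_) (sym (+-identityʳ L₁)) x<L₁)))
  ⇒ (inj₂ L₁+y+1≡x) = ⊥-elim (<-irrefl refl (≤-trans (s≤s (m≤m+n L₁ y)) (≤-trans (≤-reflexive L₁+y+1≡x) (<⇒≤ x<L₁))))
  ⇐ : suc x ≡ L₁ × y ≡ 0 → Adjacentℕ x (L₁ + y)
  ⇐ (x+1≡L₁ , refl) = inj₁ (trans x+1≡L₁ (sym (+-identityʳ L₁)))

data ++-View (L₁ L₂ : ℕ) : Fin (L₁ + L₂) → Set where
  inˡ : (k : Fin L₁) → ++-View L₁ L₂ (k ↑ˡ L₂)
  inʳ : (k : Fin L₂) → ++-View L₁ L₂ (L₁ ↑ʳ k)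

++-view : ∀ L₁ L₂ (i : Fin (L₁ + L₂)) → ++-View L₁ L₂ i
++-view L₁ L₂ i with splitAt L₁ i in eq
... | inj₁ k = subst (++-View L₁ L₂) (splitAt⁻¹-↑ˡ eq) (inˡ k)
... | inj₂ k = subst (++-View L₁ L₂) (splitAt⁻¹-↑ʳ eq) (inʳ k)

module _ {n : ℕ} where

  IsPath : Graph n → ∀ {L} → (Fin L → Fin n) → Set
  IsPath H p = Injective _≡_ _≡_ p × (∀ i j → H (p i) (p j) ≡ true ⇔ Consecutive i j)

  NeighbourClosed : Graph n → ∀ {L} → (Fin L → Fin n) → Set
  NeighbourClosed H p = ∀ i w → H (p i) w ≡ true → ∃ λ j → p j ≡ w

  module _ {H : Graph n} {L} {p : Fin L → Fin n} (sym-H : Symmetric H) (path : IsPath H p) where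

    private
      Reach-from-0 : (0<L : 0 < L) → ∀ k (k<L : k < L) → Reach H (p (fromℕ< 0<L)) (p (fromℕ< k<L))
      Reach-from-0 0<L zero 0<L′ = subst (λ i → Reach H (p (fromℕ< 0<L)) (p i)) (fromℕ<-cong 0 0 refl 0<L 0<L′) here
      Reach-from-0 0<L (suc k) k+1<L = step (Reach-from-0 0<L k (<-trans (n<1+n k) k+1<L))
        (from (proj₂ path _ _) (inj₁ (trans (cong suc (toℕ-fromℕ< _)) (sym (toℕ-fromℕ< k+1<L)))))

    Reach-on-path : ∀ i j → Reach H (p i) (p j)
    Reach-on-path i j = Reach-trans (Reach-sym sym-H (from-0 i)) (from-0 j)
      where
      0<L : 0 < L
      0<L = ≤-trans (s≤s z≤n) (toℕ<n i)
      from-0 : ∀ k → Reach H (p (fromℕ< 0<L)) (p k)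
      from-0 k = subst (λ k′ → Reach H _ (p k′)) (fromℕ<-toℕ k (toℕ<n k)) (Reach-from-0 0<L (toℕ k) (toℕ<n k))

    NeighbourClosed⇒IsPathComp : NeighbourClosed H p → ∀ i → IsPathComp H (p i) L
    NeighbourClosed⇒IsPathComp closed i =
      p , proj₁ path , (λ u → mk⇔ (on-path u) (λ { (j , refl) → Reach-on-path i j })) , proj₂ path
      where
      on-path : ∀ u → Reach H (p i) u → ∃ λ j → p j ≡ u
      on-path u here = i , refl
      on-path u (step {v} r e) with on-path v r
      ... | j , refl = closed j u e

  IsPath-++ : ∀ {H : Graph n} {L₁ L₂} {p : Fin L₁ → Fin n} {q : Fin L₂ → Fin n} → Symmetric H →
    IsPath H p → IsPath H q → (∀ i j → p i ≢ q j) →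
    (∀ i j → H (p i) (q j) ≡ true ⇔ (suc (toℕ i) ≡ L₁ × toℕ j ≡ 0)) →
    IsPath H (p Vector.++ q)
  IsPath-++ {H} {L₁} {L₂} {p} {q} sym-H (p-inj , p-adj) (q-inj , q-adj) disjoint joint = inj , adj
    where
    pq = p Vector.++ q
    at-left : ∀ k → pq (k ↑ˡ L₂) ≡ p k
    at-left = lookup-++ˡ p q
    at-right : ∀ k → pq (L₁ ↑ʳ k) ≡ q k
    at-right = lookup-++ʳ p q
    inj : Injective _≡_ _≡_ pq
    inj {i} {j} eq with ++-view L₁ L₂ i | ++-view L₁ L₂ j
    ... | inˡ k | inˡ k′ = cong (_↑ˡ L₂) (p-inj (trans (sym (at-left k)) (trans eq (at-left k′))))
    ... | inˡ k | inʳ k′ = ⊥-elim (disjoint k k′ (trans (sym (at-left k)) (trans eq (at-right k′))))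
    ... | inʳ k | inˡ k′ = ⊥-elim (disjoint k′ k (trans (sym (at-left k′)) (trans (sym eq) (at-right k))))
    ... | inʳ k | inʳ k′ = cong (L₁ ↑ʳ_) (q-inj (trans (sym (at-right k)) (trans eq (at-right k′))))
    H-cong : ∀ {u u′ v v′} → u ≡ u′ → v ≡ v′ → (H u v ≡ true) ⇔ (H u′ v′ ≡ true)
    H-cong refl refl = mk⇔ (λ e → e) (λ e → e)
    H-sym : ∀ u v → (H u v ≡ true) ⇔ (H v u ≡ true)
    H-sym u v = mk⇔ (trans (sym-H v u)) (trans (sym-H u v))
    Adjacentℕ-swap : ∀ {x y} → Adjacentℕ x y ⇔ Adjacentℕ y x
    Adjacentℕ-swap = mk⇔ Adjacentℕ-sym Adjacentℕ-sym
    ≡-Adjacentℕ : ∀ {x x′ y y′} → x ≡ x′ → y ≡ y′ → Adjacentℕ x y ⇔ Adjacentℕ x′ y′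
    ≡-Adjacentℕ refl refl = mk⇔ (λ a → a) (λ a → a)
    across : ∀ k k′ → H (p k) (q k′) ≡ true ⇔ Consecutive (k ↑ˡ L₂) (L₁ ↑ʳ k′)
    across k k′ = ≡-Adjacentℕ (sym (toℕ-↑ˡ k L₂)) (sym (toℕ-↑ʳ L₁ k′))
      ⇔-∘ (⇔-sym (Adjacentℕ-across (toℕ<n k)) ⇔-∘ joint k k′)
    adj : ∀ i j → H (pq i) (pq j) ≡ true ⇔ Consecutive i j
    adj i j with ++-view L₁ L₂ i | ++-view L₁ L₂ j
    ... | inˡ k | inˡ k′ =
      ≡-Adjacentℕ (sym (toℕ-↑ˡ k L₂)) (sym (toℕ-↑ˡ k′ L₂)) ⇔-∘ (p-adj k k′ ⇔-∘ H-cong (at-left k) (at-left k′))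
    ... | inˡ k | inʳ k′ = across k k′ ⇔-∘ H-cong (at-left k) (at-right k′)
    ... | inʳ k | inˡ k′ = Adjacentℕ-swap ⇔-∘ (across k′ k ⇔-∘ (H-sym _ _ ⇔-∘ H-cong (at-right k) (at-left k′)))
    ... | inʳ k | inʳ k′ = ≡-Adjacentℕ (sym (toℕ-↑ʳ L₁ k)) (sym (toℕ-↑ʳ L₁ k′)) ⇔-∘
      (⇔-sym (Adjacentℕ-+ˡ L₁) ⇔-∘ (q-adj k k′ ⇔-∘ H-cong (at-right k) (at-right k′)))

-- Sorted pairs

module _ {n : ℕ} where

  sortedPair : Fin n → Fin n → Fin n × Fin n
  sortedPair u v with toℕ u <? toℕ v
  ... | yes _ = u , v
  ... | no _ = v , u

  Sorted : Fin n × Fin n → Set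
  Sorted (u , v) = toℕ u < toℕ v

  sortedPair-< : ∀ {u v} → toℕ u < toℕ v → sortedPair u v ≡ (u , v)
  sortedPair-< {u} {v} u<v with toℕ u <? toℕ v
  ... | yes _ = refl
  ... | no u≮v = ⊥-elim (u≮v u<v)

  sortedPair-> : ∀ {u v} → toℕ v < toℕ u → sortedPair u v ≡ (v , u)
  sortedPair-> {u} {v} v<u with toℕ u <? toℕ v
  ... | yes u<v = ⊥-elim (<-asym u<v v<u)
  ... | no _ = refl

  sortedPair-cases : ∀ u v → sortedPair u v ≡ (u , v) ⊎ sortedPair u v ≡ (v , u)
  sortedPair-cases u v with toℕ u <? toℕ v
  ... | yes _ = inj₁ refl
  ... | no _ = inj₂ refl

  sortedPair-sorted : ∀ {u v} → u ≢ v → Sorted (sortedPair u v)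
  sortedPair-sorted {u} {v} u≢v with <-cmp (toℕ u) (toℕ v)
  ... | tri< u<v _ _ rewrite sortedPair-< u<v = u<v
  ... | tri≈ _ u≡v _ = ⊥-elim (u≢v (toℕ-injective u≡v))
  ... | tri> _ _ v<u rewrite sortedPair-> v<u = v<u

  sortedPair-edge : ∀ {H : Graph n} → Symmetric H → ∀ {u v} → H u v ≡ true → u ≢ v →
    Sorted (sortedPair u v) × H (proj₁ (sortedPair u v)) (proj₂ (sortedPair u v)) ≡ true
  sortedPair-edge sym-H {u} {v} uv u≢v with sortedPair-cases u v
  ... | inj₁ eq rewrite eq = subst Sorted eq (sortedPair-sorted u≢v) , uv
  ... | inj₂ eq rewrite eq = subst Sorted eq (sortedPair-sorted u≢v) , trans (sym-H v u) uv

  private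
    split : ∀ {a b c d : Fin n} → (a , b) ≡ (c , d) → a ≡ c × b ≡ d
    split eq = ,-injectiveˡ eq , ,-injectiveʳ eq
    swap : ∀ {a b c d : Fin n} → a ≡ c × b ≡ d → b ≡ d × a ≡ c
    swap (x , y) = y , x

  sortedPair-injective : ∀ {u v u′ v′} → sortedPair u v ≡ sortedPair u′ v′ → (u ≡ u′ × v ≡ v′) ⊎ (u ≡ v′ × v ≡ u′)
  sortedPair-injective {u} {v} {u′} {v′} eq with sortedPair-cases u v | sortedPair-cases u′ v′
  ... | inj₁ p | inj₁ q = inj₁ (split (trans (sym p) (trans eq q)))
  ... | inj₁ p | inj₂ q = inj₂ (split (trans (sym p) (trans eq q)))
  ... | inj₂ p | inj₁ q = inj₂ (swap (split (trans (sym p) (trans eq q))))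
  ... | inj₂ p | inj₂ q = inj₁ (swap (split (trans (sym p) (trans eq q))))

-- Cycles opened into paths

module _ {n : ℕ} where

  record Cycle (F : Graph n) (r : Fin n) : Set where
    field
      m : ℕ
      h : Fin (suc m) → Fin n
      h-injective : Injective _≡_ _≡_ h
      3≤size : 3 ≤ suc m
      h-onto : ∀ u → Reach F r u ⇔ (∃ λ i → h i ≡ u)
      h-adj : ∀ i j → F (h i) (h j) ≡ true ⇔ (CycAdj (suc m) i j ⊎ CycAdj (suc m) j i)

    size : ℕ
    size = suc m

    first last : Fin size
    first = Fin.zero
    last = fromℕ m

    -- The F-edge from the last to the first vertex is the one removed to open the cycle.
    Closing : Fin size → Fin size → Set
    Closing i j = toℕ i ≡ m × toℕ j ≡ 0

    h∈ : ∀ i → Reach F r (h i)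
    h∈ i = from (h-onto (h i)) (i , refl)

    index : ∀ {u} → Reach F r u → Fin size
    index r⇝u = proj₁ (to (h-onto _) r⇝u)

    h-index : ∀ {u} (r⇝u : Reach F r u) → h (index r⇝u) ≡ u
    h-index r⇝u = proj₂ (to (h-onto _) r⇝u)

    Closing⇔ : ∀ i j → (h i ≡ h last × h j ≡ h first) ⇔ Closing i j
    Closing⇔ i j = mk⇔ (λ (i≡ , j≡) → trans (cong toℕ (h-injective i≡)) (toℕ-fromℕ m) , cong toℕ (h-injective j≡))
      (λ (i≡ , j≡) → cong h (toℕ-injective (trans i≡ (sym (toℕ-fromℕ m)))) , cong h (toℕ-injective j≡))

    Consecutive⇔ : ∀ i j → ((CycAdj size i j ⊎ CycAdj size j i) × ¬ Closing i j × ¬ Closing j i) ⇔ Consecutive i j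
    Consecutive⇔ i j = mk⇔ ⇒ ⇐
      where
      wraps : ∀ {i j : Fin size} → suc (toℕ i) ≡ toℕ j → ¬ Closing j i
      wraps i+1≡j (j≡m , i≡0) = <-irrefl refl (≤-trans 3≤size (≤-reflexive (cong suc
        (trans (sym j≡m) (trans (sym i+1≡j) (cong suc i≡0))))))
      starts : ∀ {i j : Fin size} → suc (toℕ i) ≡ toℕ j → ¬ Closing i j
      starts i+1≡j (_ , j≡0) = 0≢1+n (trans (sym j≡0) (sym i+1≡j))
      ⇒ : (CycAdj size i j ⊎ CycAdj size j i) × ¬ Closing i j × ¬ Closing j i → Consecutive i j
      ⇒ (inj₁ (inj₁ i+1≡j) , _ , _) = inj₁ i+1≡j
      ⇒ (inj₁ (inj₂ (i+1≡M , j≡0)) , ¬closing , _) = ⊥-elim (¬closing (suc-injective i+1≡M , j≡0))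
      ⇒ (inj₂ (inj₁ j+1≡i) , _ , _) = inj₂ j+1≡i
      ⇒ (inj₂ (inj₂ (j+1≡M , i≡0)) , _ , ¬closing) = ⊥-elim (¬closing (suc-injective j+1≡M , i≡0))
      ⇐ : Consecutive i j → (CycAdj size i j ⊎ CycAdj size j i) × ¬ Closing i j × ¬ Closing j i
      ⇐ (inj₁ i+1≡j) = inj₁ (inj₁ i+1≡j) , starts i+1≡j , wraps i+1≡j
      ⇐ (inj₂ j+1≡i) = inj₂ (inj₁ j+1≡i) , wraps j+1≡i , starts j+1≡i

    opened-IsPath : ∀ (H : Graph n) →
      (∀ i j → H (h i) (h j) ≡ true ⇔ (F (h i) (h j) ≡ true × ¬ Closing i j × ¬ Closing j i)) → IsPath H h
    opened-IsPath H H⇔ = h-injective , λ i j → mk⇔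
      (λ uv → let (fuv , ¬c , ¬c′) = to (H⇔ i j) uv in to (Consecutive⇔ i j) (to (h-adj i j) fuv , ¬c , ¬c′))
      (λ cons → let (adj , ¬c , ¬c′) = from (Consecutive⇔ i j) cons in from (H⇔ i j) (from (h-adj i j) adj , ¬c , ¬c′))

    edgeList : List (Fin n × Fin n)
    edgeList = map (λ i → sortedPair (h i) (h (next i))) (allFin size)

    length-edgeList : length edgeList ≡ size
    length-edgeList = trans (length-map _ (allFin size)) (length-tabulate (λ i → i))

    ∈-edgeList : ∀ {u v} → Reach F r u → F u v ≡ true → toℕ u < toℕ v → (u , v) ∈ edgeList
    ∈-edgeList {u} {v} r⇝u uv u<v with index r⇝u | h-index r⇝u
    ... | i | refl with to (h-onto v) (step r⇝u uv)
    ... | j , refl with to (h-adj i j) uv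
    ... | inj₁ i→j = subst (_∈ edgeList)
      (trans (cong (λ k → sortedPair (h i) (h k)) (CycAdj-functional (CycAdj-next i) i→j)) (sortedPair-< u<v))
      (∈-map⁺ _ (∈-allFin i))
    ... | inj₂ j→i = subst (_∈ edgeList)
      (trans (cong (λ k → sortedPair (h j) (h k)) (CycAdj-functional (CycAdj-next j) j→i)) (sortedPair-> u<v))
      (∈-map⁺ _ (∈-allFin j))

  rotateCycle : ∀ {F : Graph n} {r m} → IsCycleComp F r (suc m) → Fin (suc m) → Cycle F r
  rotateCycle {m = m} (3≤M , g , g-inj , g-onto , g-adj) j₀ = record
    { m = m
    ; h = λ i → g (rotate i)
    ; h-injective = λ eq → rotate-injective (g-inj eq)
    ; 3≤size = 3≤M
    ; h-onto = λ u → mk⇔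
        (λ r⇝u → let (j , gj≡u) = to (g-onto u) r⇝u ; (i , i↦j) = rotate-surjective j in i , trans (cong g i↦j) gj≡u)
        (λ (i , eq) → from (g-onto u) (rotate i , eq))
    ; h-adj = λ i j → mk⇔
        (λ uv → Sum.map (to (rotate-CycAdj i j)) (to (rotate-CycAdj j i)) (to (g-adj (rotate i) (rotate j)) uv))
        (λ adj → from (g-adj (rotate i) (rotate j)) (Sum.map (from (rotate-CycAdj i j)) (from (rotate-CycAdj j i)) adj))
    }
    where open Rotation j₀

  Cycle-from : ∀ {F : Graph n} {r M t} → IsCycleComp F r M → Reach F r t →
    Σ (Cycle F r) λ X → Cycle.size X ≡ M × Cycle.h X (Cycle.first X) ≡ t
  Cycle-from {M = suc _} {t} cycle@(_ , g , _ , g-onto , _) r⇝t =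
    rotateCycle cycle j , refl , trans (cong g (Rotation.rotate-zero j)) gj≡t
    where
    j = proj₁ (to (g-onto t) r⇝t)
    gj≡t = proj₂ (to (g-onto t) r⇝t)

  Cycle-to : ∀ {F : Graph n} {r M t} → IsCycleComp F r M → Reach F r t →
    Σ (Cycle F r) λ X → Cycle.size X ≡ M × Cycle.h X (Cycle.last X) ≡ t
  Cycle-to {M = suc m} {t} cycle@(_ , g , _ , g-onto , _) r⇝t =
    rotateCycle cycle (next j) , refl , trans (cong g last↦j) gj≡t
    where
    j = proj₁ (to (g-onto t) r⇝t)
    gj≡t = proj₂ (to (g-onto t) r⇝t)
    -- Rotating by next j sends the last index to prev (next j), which is j.
    last↦j : Rotation.rotate (next j) (fromℕ m) ≡ j
    last↦j = trans (cong (λ x → fin% (toℕ (next j) + x)) (toℕ-fromℕ m))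
      (CycAdj-injective (CycAdj-prev (next j)) (CycAdj-next j))

module _ {n : ℕ} {H : Graph n} (sym-H : Symmetric H) {L : ℕ} {p : Fin (suc L) → Fin n} (path : IsPath H p) where

  private
    p-inj = proj₁ path

    step-edge : ∀ i → H (p (inject₁ i)) (p (Fin.suc i)) ≡ true
    step-edge i = from (proj₂ path _ _) (inj₁ (cong suc (toℕ-inject₁ i)))

    step-≢ : ∀ i → p (inject₁ i) ≢ p (Fin.suc i)
    step-≢ i eq = 1+n≢n (sym (trans (sym (toℕ-inject₁ i)) (cong toℕ (p-inj eq))))

  pathEdge : Fin L → Fin n × Fin n
  pathEdge i = sortedPair (p (inject₁ i)) (p (Fin.suc i))

  pathEdges : List (Fin n × Fin n)
  pathEdges = map pathEdge (allFin L)

  length-pathEdges : length pathEdges ≡ L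
  length-pathEdges = trans (length-map _ (allFin L)) (length-tabulate (λ i → i))

  pathEdge-injective : Injective _≡_ _≡_ pathEdge
  pathEdge-injective {i} {j} eq with sortedPair-injective eq
  ... | inj₁ (same , _) = Fin.inject₁-injective (p-inj same)
  ... | inj₂ (crossed₁ , crossed₂) = ⊥-elim (<-irrefl refl (≤-trans (n≤1+n (suc (toℕ i)))
    (≤-reflexive (sym (trans i≡j+1 (cong suc (sym j≡i+1)))))))
    where
    i≡j+1 : toℕ i ≡ suc (toℕ j)
    i≡j+1 = trans (sym (toℕ-inject₁ i)) (cong toℕ (p-inj crossed₁))
    j≡i+1 : suc (toℕ i) ≡ toℕ j
    j≡i+1 = trans (cong toℕ (p-inj crossed₂)) (toℕ-inject₁ j)

  pathEdges-unique : Unique pathEdges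
  pathEdges-unique = Unique.map⁺ pathEdge-injective (Unique.allFin⁺ L)

  ∈-pathEdges : ∀ {e} → e ∈ pathEdges →
    (Sorted e × H (proj₁ e) (proj₂ e) ≡ true) × ∃ λ i → p i ≡ proj₁ e
  ∈-pathEdges e∈ with ∈-map⁻ pathEdge e∈
  ... | i , _ , refl = sortedPair-edge sym-H (step-edge i) (step-≢ i) , start
    where
    start : ∃ λ k → p k ≡ proj₁ (pathEdge i)
    start with sortedPair-cases (p (inject₁ i)) (p (Fin.suc i))
    ... | inj₁ eq = inject₁ i , cong proj₁ (sym eq)
    ... | inj₂ eq = Fin.suc i , cong proj₁ (sym eq)

-- The numerical bound

module _ where

  open import Data.Integer using (+_)

  private
    -x*-x≡x*x : ∀ x → (ℤ.- + x) ℤ.* (ℤ.- + x) ≡ + (x * x)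
    -x*-x≡x*x zero = refl
    -x*-x≡x*x (suc x) = refl

    -x<0 : ∀ {x} → 0 < x → ℤ.- + x ℤ.< + 0
    -x<0 {suc x} _ = ℤ.-<+

  NonNegSqrt11-++ : ∀ x y → NonNegSqrt11 (+ x) (+ y)
  NonNegSqrt11-++ x y = inj₁ (ℤ.+≤+ z≤n , ℤ.+≤+ z≤n)

  NonNegSqrt11-+- : ∀ x y → 0 < y → 11 * (y * y) ≤ x * x → NonNegSqrt11 (+ x) (ℤ.- + y)
  NonNegSqrt11-+- x y 0<y 11y²≤x² = inj₂ (inj₁ (ℤ.+≤+ z≤n , -x<0 0<y ,
    subst₂ ℤ._≤_ (trans (ℤ.pos-* 11 (y * y)) (cong (λ z → + 11 ℤ.* z) (sym (-x*-x≡x*x y)))) (ℤ.pos-* x x) (ℤ.+≤+ 11y²≤x²)))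

  NonNegSqrt11--+ : ∀ x y → 0 < x → x * x ≤ 11 * (y * y) → NonNegSqrt11 (ℤ.- + x) (+ y)
  NonNegSqrt11--+ x y 0<x x²≤11y² = inj₂ (inj₂ (-x<0 0<x , ℤ.+≤+ z≤n ,
    subst₂ ℤ._≤_ (sym (-x*-x≡x*x x)) (trans (ℤ.pos-* 11 (y * y)) (cong (λ z → + 11 ℤ.* z) (ℤ.pos-* y y))) (ℤ.+≤+ x²≤11y²)))

  private
    7e-9f+19≡⊖ : ∀ e f → + 7 ℤ.* + e ℤ.- + 9 ℤ.* + f ℤ.+ + 19 ≡ (7 * e + 19) ℤ.⊖ (9 * f)
    7e-9f+19≡⊖ e f = begin
      + 7 ℤ.* + e ℤ.- + 9 ℤ.* + f ℤ.+ + 19      ≡⟨ cong₂ (λ x y → x ℤ.- y ℤ.+ + 19) (sym (ℤ.pos-* 7 e)) (sym (ℤ.pos-* 9 f)) ⟩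
      + (7 * e) ℤ.- + (9 * f) ℤ.+ + 19          ≡⟨ ℤ.+-assoc (+ (7 * e)) (ℤ.- + (9 * f)) (+ 19) ⟩
      + (7 * e) ℤ.+ (ℤ.- + (9 * f) ℤ.+ + 19)    ≡⟨ cong (λ z → + (7 * e) ℤ.+ z) (ℤ.+-comm (ℤ.- + (9 * f)) (+ 19)) ⟩
      + (7 * e) ℤ.+ (+ 19 ℤ.- + (9 * f))        ≡⟨ sym (ℤ.+-assoc (+ (7 * e)) (+ 19) (ℤ.- + (9 * f))) ⟩
      + (7 * e) ℤ.+ + 19 ℤ.- + (9 * f)          ≡⟨ cong (λ z → z ℤ.- + (9 * f)) (sym (ℤ.pos-+ (7 * e) 19)) ⟩
      + (7 * e + 19) ℤ.- + (9 * f)              ≡⟨ ℤ.m-n≡m⊖n (7 * e + 19) (9 * f) ⟩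
      (7 * e + 19) ℤ.⊖ (9 * f)                  ∎
      where open ≡-Reasoning

    ExhaustiveCase : ℕ → ℕ → Set
    ExhaustiveCase e f = 10 ≤ e → f ≤ 2 + e → 7 * e + 19 < 9 * f →
      (9 * f ∸ (7 * e + 19)) * (9 * f ∸ (7 * e + 19)) ≤ 11 * ((f ∸ 6) * (f ∸ 6))

    exhaustive-check : ∀ (e : Fin 17) (f : Fin 16) → ExhaustiveCase (toℕ e) (toℕ f)
    exhaustive-check = toWitness {a? = all? λ e → all? λ f →
      (10 ℕ.≤? toℕ e) →-dec ((toℕ f ℕ.≤? 2 + toℕ e) →-dec ((7 * toℕ e + 19 <? 9 * toℕ f) →-dec (_ ℕ.≤? _)))} _

    -- When 7e + 19 < 9f the side conditions force e ≤ 16, so finitely many cases remain.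
    negative-case : ∀ e f → f ≤ 15 → ExhaustiveCase e f
    negative-case e f f≤15 10≤e f≤e+2 7e+19<9f = subst₂ ExhaustiveCase (toℕ-fromℕ< e<17) (toℕ-fromℕ< (s≤s f≤15))
      (exhaustive-check (fromℕ< e<17) (fromℕ< (s≤s f≤15))) 10≤e f≤e+2 7e+19<9f
      where
      e<17 : e < 17
      e<17 = s≤s (≮⇒≥ λ 16<e → <-irrefl refl
        (≤-trans 7e+19<9f (≤-trans (*-monoʳ-≤ 9 f≤15) (≤-trans (m≤m+n 135 3) (+-monoˡ-≤ 19 (*-monoʳ-≤ 7 16<e))))))

    negative-case⇒6≤f : ∀ e f → 10 ≤ e → 7 * e + 19 < 9 * f → 6 ≤ f
    negative-case⇒6≤f e f 10≤e 7e+19<9f = ≮⇒≥ λ f<6 → <-irrefl refl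
      (≤-trans 7e+19<9f (≤-trans (*-monoʳ-≤ 9 (≤-pred f<6)) (≤-trans (m≤m+n 45 44) (+-monoˡ-≤ 19 (*-monoʳ-≤ 7 10≤e)))))

  bound : ∀ e f → 10 ≤ e → f ≤ 2 + e → f ≤ 15 → BoundHolds e f
  bound e f 10≤e f≤e+2 f≤15 = subst (λ p → NonNegSqrt11 p (+ f ℤ.- + 6)) (sym (7e-9f+19≡⊖ e f))
    (subst (NonNegSqrt11 ((7 * e + 19) ℤ.⊖ (9 * f))) (sym (ℤ.m-n≡m⊖n f 6)) by-signs)
    where
    by-signs : NonNegSqrt11 ((7 * e + 19) ℤ.⊖ (9 * f)) (f ℤ.⊖ 6)
    by-signs with 9 * f ℕ.≤? 7 * e + 19
    ... | yes 9f≤7e+19 with 6 ℕ.≤? f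
    ...   | yes 6≤f rewrite ℤ.⊖-≥ 9f≤7e+19 | ℤ.⊖-≥ 6≤f = NonNegSqrt11-++ _ _
    ...   | no 6≰f rewrite ℤ.⊖-≥ 9f≤7e+19 | ℤ.⊖-< (≰⇒> 6≰f) =
      NonNegSqrt11-+- _ _ (m<n⇒0<n∸m (≰⇒> 6≰f)) (≤-trans (*-monoʳ-≤ 11 (*-mono-≤ 6-f≤6 6-f≤6))
        (≤-trans (m≤m+n 396 1540) (*-mono-≤ 44≤p 44≤p)))
      where
      6-f≤6 : 6 ∸ f ≤ 6
      6-f≤6 = m∸n≤m 6 f
      44≤p : 44 ≤ 7 * e + 19 ∸ 9 * f
      44≤p = ∸-mono (+-monoˡ-≤ 19 (*-monoʳ-≤ 7 10≤e)) (*-monoʳ-≤ 9 (≤-pred (≰⇒> 6≰f)))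
    by-signs | no 9f≰7e+19 rewrite ℤ.⊖-< (≰⇒> 9f≰7e+19) | ℤ.⊖-≥ (negative-case⇒6≤f e f 10≤e (≰⇒> 9f≰7e+19)) =
      NonNegSqrt11--+ _ _ (m<n⇒0<n∸m (≰⇒> 9f≰7e+19)) (negative-case e f f≤15 10≤e f≤e+2 (≰⇒> 9f≰7e+19))

-- The balanced component

data Part : Set where
  centre left right : Part

module BalancedComponent {n : ℕ} {G F G′ W : Graph n} (pcc-F : PathCycleCover G F) (G′-def : IsG' G F G′)
  (pcc-W : PathCycleCover G′ W) (stingy : Stingy F W) {x c a : Fin n} (x⇝c : Reach (F ⊕ W) x c)
  (c-short : InShort F c) (c⇝a : Reach F c a) (deg-a≡2 : deg W a ≡ 2) (deg≡0 : ∀ b → Reach F c b → b ≢ a → deg W b ≡ 0)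
  where

  open TwoNeighbours (deg≡2⇒TwoNeighbours W a deg-a≡2)
    renaming (u₁ to b₁; u₂ to b₂; u₁≢u₂ to b₁≢b₂; adj₁ to ab₁; adj₂ to ab₂; only to W-from-a)

  sym-F : Symmetric F
  sym-F = proj₁ (proj₁ pcc-F)

  sym-W : Symmetric W
  sym-W = proj₁ (proj₁ pcc-W)

  W-between : ∀ {u v} → W u v ≡ true → ¬ Reach F u v
  W-between {u} {v} uv = proj₁ (proj₂ (to (G′-def u v) (proj₁ (proj₂ pcc-W) u v uv)))

  W-from-centre : ∀ {u w} → Reach F c u → W u w ≡ true → u ≡ a
  W-from-centre {u} {w} c⇝u uw with u Fin.≟ a
  ... | yes u≡a = u≡a
  ... | no u≢a with () ← trans (sym uw) (deg≡0⇒nonadjacent W u (deg≡0 u c⇝u u≢a) w)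

  pendant₁ : Pendant F W a b₁
  pendant₁ = Stingy⇒Pendant pcc-F W-between stingy ab₁ ab₂ b₁≢b₂

  pendant₂ : Pendant F W a b₂
  pendant₂ = Stingy⇒Pendant pcc-F W-between stingy ab₂ ab₁ (λ b₂≡b₁ → b₁≢b₂ (sym b₂≡b₁))

  root : Part → Fin n
  root centre = c
  root left = b₁
  root right = b₂

  InPart : Part → Fin n → Set
  InPart p u = Reach F (root p) u

  short : ∀ p → InShort F (root p)
  short centre = c-short
  short left = proj₁ pendant₁
  short right = proj₁ pendant₂

  centre∩left : ∀ {u} → InPart centre u → InPart left u → ⊥
  centre∩left c⇝u b₁⇝u = W-between ab₁ (Reach-trans (Reach-sym sym-F c⇝a) (Reach-trans c⇝u (Reach-sym sym-F b₁⇝u)))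

  centre∩right : ∀ {u} → InPart centre u → InPart right u → ⊥
  centre∩right c⇝u b₂⇝u = W-between ab₂ (Reach-trans (Reach-sym sym-F c⇝a) (Reach-trans c⇝u (Reach-sym sym-F b₂⇝u)))

  left∩right : ∀ {u} → InPart left u → InPart right u → ⊥
  left∩right b₁⇝u b₂⇝u =
    b₁≢b₂ (sym (proj₁ (proj₂ pendant₁ b₂ (Reach-trans b₁⇝u (Reach-sym sym-F b₂⇝u)) a (trans (sym-W b₂ a) ab₂))))

  parts-disjoint : ∀ p q {u} → InPart p u → InPart q u → p ≡ q
  parts-disjoint centre centre _ _ = refl
  parts-disjoint left left _ _ = refl
  parts-disjoint right right _ _ = refl
  parts-disjoint centre left cu lu = ⊥-elim (centre∩left cu lu)
  parts-disjoint left centre lu cu = ⊥-elim (centre∩left cu lu)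
  parts-disjoint centre right cu ru = ⊥-elim (centre∩right cu ru)
  parts-disjoint right centre ru cu = ⊥-elim (centre∩right cu ru)
  parts-disjoint left right lu ru = ⊥-elim (left∩right lu ru)
  parts-disjoint right left ru lu = ⊥-elim (left∩right lu ru)

  InK : Fin n → Set
  InK u = ∃ λ p → InPart p u

  InK-F-closed : ∀ {u v} → InK u → F u v ≡ true → InK v
  InK-F-closed (p , r⇝u) uv = p , step r⇝u uv

  InK-W-closed : ∀ {u w} → InK u → W u w ≡ true → InK w
  InK-W-closed (centre , c⇝u) uw with W-from-centre c⇝u uw
  ... | refl with W-from-a _ uw
  ...   | inj₁ refl = left , here
  ...   | inj₂ refl = right , here
  InK-W-closed (left , b₁⇝u) uw with proj₂ pendant₁ _ b₁⇝u _ uw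
  ... | _ , refl = centre , c⇝a
  InK-W-closed (right , b₂⇝u) uw with proj₂ pendant₂ _ b₂⇝u _ uw
  ... | _ , refl = centre , c⇝a

  F⊆F⊕W : ∀ u v → F u v ≡ true → (F ⊕ W) u v ≡ true
  F⊆F⊕W u v uv rewrite uv = refl

  W⊆F⊕W : ∀ u v → W u v ≡ true → (F ⊕ W) u v ≡ true
  W⊆F⊕W u v uv rewrite uv = ∨-zeroʳ (F u v)

  K⇔ : ∀ u → Reach (F ⊕ W) x u ⇔ InK u
  K⇔ u = mk⇔ (λ x⇝u → from-c (Reach-trans (Reach-sym sym-F⊕W x⇝c) x⇝u)) (λ u∈K → Reach-trans x⇝c (to-c u∈K))
    where
    sym-F⊕W : Symmetric (F ⊕ W)
    sym-F⊕W u v = cong₂ _∨_ (sym-F u v) (sym-W u v)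
    from-c : ∀ {v} → Reach (F ⊕ W) c v → InK v
    from-c here = centre , here
    from-c (step {v} {w} c⇝v vw) with F v w in fvw
    ... | true = InK-F-closed (from-c c⇝v) fvw
    ... | false = InK-W-closed (from-c c⇝v) vw
    to-c : ∀ {v} → InK v → Reach (F ⊕ W) c v
    to-c (centre , c⇝v) = Reach-mono F⊆F⊕W c⇝v
    to-c (left , b₁⇝v) = Reach-trans (step (Reach-mono F⊆F⊕W c⇝a) (W⊆F⊕W a b₁ ab₁)) (Reach-mono F⊆F⊕W b₁⇝v)
    to-c (right , b₂⇝v) = Reach-trans (step (Reach-mono F⊆F⊕W c⇝a) (W⊆F⊕W a b₂ ab₂)) (Reach-mono F⊆F⊕W b₂⇝v)

  private
    size-bounds : ∀ {m} → m ≡ 4 ⊎ m ≡ 5 → 4 ≤ m × m ≤ 5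
    size-bounds (inj₁ refl) = ≤-refl , n≤1+n 4
    size-bounds (inj₂ refl) = n≤1+n 4 , ≤-refl

  Anchored : ∀ p → Cycle F (root p) → Set
  Anchored centre X = Cycle.h X (Cycle.first X) ≡ a
  Anchored left X = Cycle.h X (Cycle.last X) ≡ b₁
  Anchored right X = ⊤

  abstract
    opened : ∀ p → Σ (Cycle F (root p)) λ X → Cycle.size X ≡ proj₁ (short p) × Anchored p X
    opened centre = Cycle-from (proj₁ (proj₂ c-short)) c⇝a
    opened left = Cycle-to (proj₁ (proj₂ (short left))) here
    opened right = let (X , size≡ , _) = Cycle-from (proj₁ (proj₂ (short right))) here in X , size≡ , tt

  cycle : ∀ p → Cycle F (root p)
  cycle p = proj₁ (opened p)

  module _ (p : Part) where
    open Cycle (cycle p)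

    4≤size : 4 ≤ size
    4≤size = subst (4 ≤_) (sym (proj₁ (proj₂ (opened p)))) (proj₁ (size-bounds (proj₂ (proj₂ (short p)))))

    size≤5 : size ≤ 5
    size≤5 = subst (_≤ 5) (sym (proj₁ (proj₂ (opened p)))) (proj₂ (size-bounds (proj₂ (proj₂ (short p)))))

    Ends : Fin n → Fin n → Set
    Ends u v = (u ≡ h last × v ≡ h first) ⊎ (u ≡ h first × v ≡ h last)

    Ends? : ∀ u v → Dec (Ends u v)
    Ends? u v = ((u Fin.≟ h last) ×-dec (v Fin.≟ h first)) ⊎-dec ((u Fin.≟ h first) ×-dec (v Fin.≟ h last))

    Ends-sym : ∀ {u v} → Ends u v → Ends v u
    Ends-sym (inj₁ (u≡ , v≡)) = inj₂ (v≡ , u≡)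
    Ends-sym (inj₂ (u≡ , v≡)) = inj₁ (v≡ , u≡)

    Ends⇒InPart : ∀ {u v} → Ends u v → InPart p u
    Ends⇒InPart (inj₁ (refl , _)) = h∈ last
    Ends⇒InPart (inj₂ (refl , _)) = h∈ first

  a-first : Cycle.h (cycle centre) Fin.zero ≡ a
  a-first = proj₂ (proj₂ (opened centre))

  b₁-last : Cycle.h (cycle left) (Cycle.last (cycle left)) ≡ b₁
  b₁-last = proj₂ (proj₂ (opened left))

  ∃Part? : {Q : Part → Set} → (∀ p → Dec (Q p)) → Dec (∃ Q)
  ∃Part? {Q} Q? = map′ ⇒ ⇐ (Q? centre ⊎-dec (Q? left ⊎-dec Q? right))
    where
    ⇒ : Q centre ⊎ Q left ⊎ Q right → ∃ Q
    ⇒ (inj₁ q) = centre , q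
    ⇒ (inj₂ (inj₁ q)) = left , q
    ⇒ (inj₂ (inj₂ q)) = right , q
    ⇐ : ∃ Q → Q centre ⊎ Q left ⊎ Q right
    ⇐ (centre , q) = inj₁ q
    ⇐ (left , q) = inj₂ (inj₁ q)
    ⇐ (right , q) = inj₂ (inj₂ q)

  Cut : Fin n → Fin n → Set
  Cut u v = ∃ λ p → Ends p u v

  Bridge : Fin n → Fin n → Set
  Bridge u v = (u ≡ a × v ≡ b₁) ⊎ (u ≡ b₁ × v ≡ a)

  -- The k-pp: the three cycles opened at their cut edges, with the bridge {a, b₁} joining two of them.
  Kept : Fin n → Fin n → Set
  Kept u v = (F u v ≡ true × InK u × ¬ Cut u v) ⊎ Bridge u v

  abstract
    Kept? : ∀ u v → Dec (Kept u v)
    Kept? u v = ((F u v Bool.≟ true) ×-dec (∃Part? (λ p → Reach? pcc-F (root p) u) ×-dec ¬? (∃Part? λ p → Ends? p u v)))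
      ⊎-dec (((u Fin.≟ a) ×-dec (v Fin.≟ b₁)) ⊎-dec ((u Fin.≟ b₁) ×-dec (v Fin.≟ a)))

  P : Graph n
  P u v = does (Kept? u v)

  P⇔Kept : ∀ {u v} → P u v ≡ true ⇔ Kept u v
  P⇔Kept {u} {v} = does≡true⇔ (Kept? u v)

  Kept-sym : ∀ {u v} → Kept u v → Kept v u
  Kept-sym {u} {v} (inj₁ (uv , u∈K , ¬cut)) =
    inj₁ (trans (sym-F v u) uv , InK-F-closed u∈K uv , λ (p , ends) → ¬cut (p , Ends-sym p ends))
  Kept-sym (inj₂ (inj₁ (u≡a , v≡b₁))) = inj₂ (inj₂ (v≡b₁ , u≡a))
  Kept-sym (inj₂ (inj₂ (u≡b₁ , v≡a))) = inj₂ (inj₁ (v≡a , u≡b₁))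

  P-sym : Symmetric P
  P-sym u v = does-⇔ (mk⇔ Kept-sym Kept-sym) (Kept? u v) (Kept? v u)

  a≢b₁ : a ≢ b₁
  a≢b₁ a≡b₁ = W-between ab₁ (subst (Reach F a) a≡b₁ here)

  P-irrefl : ∀ u → P u u ≡ false
  P-irrefl u = dec-false (Kept? u u) λ
    { (inj₁ (fuu , _)) → case trans (sym fuu) (proj₂ (proj₁ pcc-F) u) of λ ()
    ; (inj₂ (inj₁ (u≡a , u≡b₁))) → a≢b₁ (trans (sym u≡a) u≡b₁)
    ; (inj₂ (inj₂ (u≡b₁ , u≡a))) → a≢b₁ (trans (sym u≡a) u≡b₁) }

  Cut-within : ∀ {p u v} → InPart p u → Cut u v → Ends p u v
  Cut-within {p} u∈p (q , ends) with parts-disjoint q p (Ends⇒InPart q ends) u∈p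
  ... | refl = ends

  Bridge-parts : ∀ {u v} → Bridge u v → (InPart centre u × InPart left v) ⊎ (InPart left u × InPart centre v)
  Bridge-parts (inj₁ (refl , refl)) = inj₁ (c⇝a , here)
  Bridge-parts (inj₂ (refl , refl)) = inj₂ (here , c⇝a)

  ¬Bridge-within : ∀ {p u v} → InPart p u → InPart p v → ¬ Bridge u v
  ¬Bridge-within {p} u∈p v∈p bridge with Bridge-parts bridge
  ... | inj₁ (u∈c , v∈l) with () ← trans (parts-disjoint centre p u∈c u∈p) (sym (parts-disjoint left p v∈l v∈p))
  ... | inj₂ (u∈l , v∈c) with () ← trans (parts-disjoint left p u∈l u∈p) (sym (parts-disjoint centre p v∈c v∈p))

  P-step : ∀ {p u w} → InPart p u → P u w ≡ true → InPart p w ⊎ Bridge u w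
  P-step u∈p uw with to P⇔Kept uw
  ... | inj₁ (fuw , _) = inj₁ (step u∈p fuw)
  ... | inj₂ bridge = inj₂ bridge

  cycle-IsPath : ∀ p → IsPath P (Cycle.h (cycle p))
  cycle-IsPath p = opened-IsPath P λ i j → mk⇔ (⇒ i j) (⇐ i j)
    where
    open Cycle (cycle p)
    ⇒ : ∀ i j → P (h i) (h j) ≡ true → F (h i) (h j) ≡ true × ¬ Closing i j × ¬ Closing j i
    ⇒ i j hij with to P⇔Kept hij
    ... | inj₁ (fij , _ , ¬cut) = fij ,
      (λ closing → ¬cut (p , inj₁ (from (Closing⇔ i j) closing))) ,
      (λ closing → let (j≡ , i≡) = from (Closing⇔ j i) closing in ¬cut (p , inj₂ (i≡ , j≡)))
    ... | inj₂ bridge = ⊥-elim (¬Bridge-within {p} (h∈ i) (h∈ j) bridge)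
    ⇐ : ∀ i j → F (h i) (h j) ≡ true × ¬ Closing i j × ¬ Closing j i → P (h i) (h j) ≡ true
    ⇐ i j (fij , ¬closing , ¬closing′) = from P⇔Kept (inj₁ (fij , (p , h∈ i) , λ cut → not-ends (Cut-within {p} (h∈ i) cut)))
      where
      not-ends : ¬ Ends p (h i) (h j)
      not-ends (inj₁ ends) = ¬closing (to (Closing⇔ i j) ends)
      not-ends (inj₂ (i≡ , j≡)) = ¬closing′ (to (Closing⇔ j i) (j≡ , i≡))

  module L = Cycle (cycle left)
  module C = Cycle (cycle centre)
  module R = Cycle (cycle right)

  -- The left cycle, ending at b₁, followed by the centre cycle, starting at a.
  joined : Fin (L.size + C.size) → Fin n
  joined = L.h Vector.++ C.h

  joined-IsPath : IsPath P joined
  joined-IsPath = IsPath-++ P-sym (cycle-IsPath left) (cycle-IsPath centre)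
    (λ i j eq → centre∩left (C.h∈ j) (subst (InPart left) eq (L.h∈ i))) joint
    where
    joint : ∀ i j → P (L.h i) (C.h j) ≡ true ⇔ (suc (toℕ i) ≡ L.size × toℕ j ≡ 0)
    joint i j = mk⇔ ⇒ ⇐
      where
      ⇒ : P (L.h i) (C.h j) ≡ true → suc (toℕ i) ≡ L.size × toℕ j ≡ 0
      ⇒ hij with P-step {left} (L.h∈ i) hij
      ... | inj₁ hj∈l = ⊥-elim (centre∩left (C.h∈ j) hj∈l)
      ... | inj₂ (inj₁ (hi≡a , _)) = ⊥-elim (centre∩left c⇝a (subst (InPart left) hi≡a (L.h∈ i)))
      ... | inj₂ (inj₂ (hi≡b₁ , hj≡a)) =
        cong suc (trans (cong toℕ (L.h-injective (trans hi≡b₁ (sym b₁-last)))) (toℕ-fromℕ L.m)) ,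
        cong toℕ (C.h-injective (trans hj≡a (sym a-first)))
      ⇐ : suc (toℕ i) ≡ L.size × toℕ j ≡ 0 → P (L.h i) (C.h j) ≡ true
      ⇐ (i+1≡size , j≡0) = from P⇔Kept (inj₂ (inj₂ (trans (cong L.h i≡last) b₁-last , trans (cong C.h j≡0′) a-first)))
        where
        i≡last : i ≡ L.last
        i≡last = toℕ-injective (trans (suc-injective i+1≡size) (sym (toℕ-fromℕ L.m)))
        j≡0′ : j ≡ Fin.zero
        j≡0′ = toℕ-injective j≡0

  joined-parts : ∀ i → InPart left (joined i) ⊎ InPart centre (joined i)
  joined-parts i with ++-view L.size C.size i
  ... | inˡ k = inj₁ (subst (InPart left) (sym (lookup-++ˡ L.h C.h k)) (L.h∈ k))
  ... | inʳ k = inj₂ (subst (InPart centre) (sym (lookup-++ʳ L.h C.h k)) (C.h∈ k))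

  on-joined : ∀ {w} → InPart left w ⊎ InPart centre w → ∃ λ j → joined j ≡ w
  on-joined (inj₁ w∈l) = L.index w∈l ↑ˡ C.size , trans (lookup-++ˡ L.h C.h _) (L.h-index w∈l)
  on-joined (inj₂ w∈c) = L.size ↑ʳ C.index w∈c , trans (lookup-++ʳ L.h C.h _) (C.h-index w∈c)

  joined-closed : NeighbourClosed P joined
  joined-closed i w edge with joined-parts i
  ... | inj₁ u∈l = on-joined (Sum.map₂ Bridge-end (P-step {left} u∈l edge))
    where
    Bridge-end : Bridge (joined i) w → InPart centre w
    Bridge-end bridge with Bridge-parts bridge
    ... | inj₁ (u∈c , _) = ⊥-elim (centre∩left u∈c u∈l)
    ... | inj₂ (_ , w∈c) = w∈c
  ... | inj₂ u∈c = on-joined (Sum.swap (Sum.map₂ Bridge-end (P-step {centre} u∈c edge)))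
    where
    Bridge-end : Bridge (joined i) w → InPart left w
    Bridge-end bridge with Bridge-parts bridge
    ... | inj₁ (_ , w∈l) = w∈l
    ... | inj₂ (u∈l , _) = ⊥-elim (centre∩left u∈c u∈l)

  right-closed : NeighbourClosed P R.h
  right-closed i w edge with P-step {right} (R.h∈ i) edge
  ... | inj₁ w∈r = R.index w∈r , R.h-index w∈r
  ... | inj₂ bridge with Bridge-parts bridge
  ...   | inj₁ (u∈c , _) = ⊥-elim (centre∩right u∈c (R.h∈ i))
  ...   | inj₂ (u∈l , _) = ⊥-elim (left∩right u∈l (R.h∈ i))

  joined-component : ∀ {v} → InPart left v ⊎ InPart centre v → ∃ λ m → IsPathComp P v m × m ≤ 10
  joined-component v∈ = L.size + C.size ,
    subst (λ u → IsPathComp P u (L.size + C.size)) (proj₂ (on-joined v∈))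
      (NeighbourClosed⇒IsPathComp P-sym joined-IsPath joined-closed (proj₁ (on-joined v∈))) ,
    +-mono-≤ (size≤5 left) (size≤5 centre)

  right-component : ∀ {v} → InPart right v → ∃ λ m → IsPathComp P v m × m ≤ 10
  right-component v∈r = R.size ,
    subst (λ u → IsPathComp P u R.size) (R.h-index v∈r)
      (NeighbourClosed⇒IsPathComp P-sym (cycle-IsPath right) right-closed (R.index v∈r)) ,
    ≤-trans (size≤5 right) (m≤m+n 5 5)

  P-components : ∀ v → InK v → ∃ λ m → IsPathComp P v m × m ≤ 10
  P-components v (left , v∈l) = joined-component (inj₁ v∈l)
  P-components v (centre , v∈c) = joined-component (inj₂ v∈c)
  P-components v (right , v∈r) = right-component v∈r

  P⊆K : ∀ u v → P u v ≡ true → (F ⊕ W) u v ≡ true × Reach (F ⊕ W) x u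
  P⊆K u v uv with to P⇔Kept uv
  ... | inj₁ (fuv , u∈K , _) = F⊆F⊕W u v fuv , from (K⇔ u) u∈K
  ... | inj₂ (inj₁ (refl , refl)) = W⊆F⊕W a b₁ ab₁ , from (K⇔ a) (centre , c⇝a)
  ... | inj₂ (inj₂ (refl , refl)) = W⊆F⊕W b₁ a (trans (sym-W b₁ a) ab₁) , from (K⇔ b₁) (left , here)

  P-isKPP : ∀ k → 10 ≤ k → KPP k F W x P
  P-isKPP k 10≤k = (P-sym , P-irrefl) , P⊆K , λ v x⇝v →
    let (m , comp , m≤10) = P-components v (to (K⇔ v) x⇝v) in m , comp , ≤-trans m≤10 10≤k

  edges-lower : L.m + C.size + R.m ≤ edges P
  edges-lower = subst (_≤ edges P)
    (trans (length-++ joinedEdges)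
      (cong₂ _+_ (length-pathEdges P-sym joined-IsPath) (length-pathEdges P-sym (cycle-IsPath right))))
    (Unique-edges≤edges P (joinedEdges ++ rightEdges)
      (Unique.++⁺ (pathEdges-unique P-sym joined-IsPath) (pathEdges-unique P-sym (cycle-IsPath right)) disjoint)
      λ e∈ → [ (λ e∈j → proj₁ (∈-pathEdges P-sym joined-IsPath e∈j)) ,
               (λ e∈r → proj₁ (∈-pathEdges P-sym (cycle-IsPath right) e∈r)) ]′ (∈-++⁻ joinedEdges e∈))
    where
    joinedEdges = pathEdges P-sym joined-IsPath
    rightEdges = pathEdges P-sym (cycle-IsPath right)
    disjoint : ∀ {e} → ¬ (e ∈ joinedEdges × e ∈ rightEdges)
    disjoint (e∈j , e∈r)
      with proj₂ (∈-pathEdges P-sym joined-IsPath e∈j) | proj₂ (∈-pathEdges P-sym (cycle-IsPath right) e∈r)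
    ... | i , refl | j , ri≡ with joined-parts i
    ...   | inj₁ u∈l = left∩right u∈l (subst (InPart right) ri≡ (R.h∈ j))
    ...   | inj₂ u∈c = centre∩right u∈c (subst (InPart right) ri≡ (R.h∈ j))

  FK-upper : ∀ {f} → FKCount F W x f → f ≤ C.size + (L.size + R.size)
  FK-upper (ys , ys! , ys⇔ , refl) = subst (length ys ≤_)
    (trans (length-++ C.edgeList) (cong₂ _+_ C.length-edgeList
      (trans (length-++ L.edgeList) (cong₂ _+_ L.length-edgeList R.length-edgeList))))
    (Unique-⊆⇒length≤ (≡-dec Fin._≟_ Fin._≟_) (C.edgeList ++ L.edgeList ++ R.edgeList) ys! λ {e} e∈ys →
      let (u<v , fuv , x⇝u) = to (ys⇔ e) e∈ys in cycle-edge (to (K⇔ (proj₁ e)) x⇝u) fuv u<v)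
    where
    cycle-edge : ∀ {u v} → InK u → F u v ≡ true → toℕ u < toℕ v → (u , v) ∈ C.edgeList ++ L.edgeList ++ R.edgeList
    cycle-edge (centre , u∈c) fuv u<v = ∈-++⁺ˡ (C.∈-edgeList u∈c fuv u<v)
    cycle-edge (left , u∈l) fuv u<v = ∈-++⁺ʳ C.edgeList (∈-++⁺ˡ (L.∈-edgeList u∈l fuv u<v))
    cycle-edge (right , u∈r) fuv u<v = ∈-++⁺ʳ C.edgeList (∈-++⁺ʳ L.edgeList (R.∈-edgeList u∈r fuv u<v))

  10≤edges : 10 ≤ edges P
  10≤edges = ≤-trans (+-mono-≤ (+-mono-≤ (≤-pred (4≤size left)) (4≤size centre)) (≤-pred (4≤size right))) edges-lower

  FK≤2+edges : ∀ {f} → FKCount F W x f → f ≤ 2 + edges P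
  FK≤2+edges fk = ≤-trans (FK-upper fk) (≤-trans (≤-reflexive (sizes L.m C.size R.m)) (+-monoʳ-≤ 2 edges-lower))
    where
    sizes : ∀ l c r → c + (suc l + suc r) ≡ 2 + (l + c + r)
    sizes = solve-∀

  FK≤15 : ∀ {f} → FKCount F W x f → f ≤ 15
  FK≤15 fk = ≤-trans (FK-upper fk) (+-mono-≤ (size≤5 centre) (+-mono-≤ (size≤5 left) (size≤5 right)))

lemma15 : (k : ℕ) → 11 ≤ k →
    (n : ℕ) (G : Graph n) → IsSimple G →
    (F : Graph n) → MaxTFPCC G F →
    (G' : Graph n) → IsG' G F G' →
    (W : Graph n) → MaxStingy G' F W →
    (x c : Fin n) → Balanced F W x c →
    (f : ℕ) → FKCount F W x f →
    ∃ λ P → KPP k F W x P × BoundHolds (edges P) f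
lemma15 k 11≤k n G _ F ((pcc-F , _) , _) G' G'-def W (pcc-W , _ , stingy) x c
  ((x⇝c , _) , c-short , a , c⇝a , deg-a≡2 , deg≡0) f fk =
  P , P-isKPP k (≤-trans (n≤1+n 10) 11≤k) , bound (edges P) f 10≤edges (FK≤2+edges fk) (FK≤15 fk)
  where open BalancedComponent pcc-F G'-def pcc-W stingy x⇝c c-short c⇝a deg-a≡2 deg≡0
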